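{- Let $p\equiv 1 \pmod 4$ be prime, let $m,n$ be integers with $p=m^2+n^2$, and let $b$ be a positive integer. Define integers $a_t$ ($t\in\mathbb{Z}$) by the Laurent series expansion \[ Q(q^{bm},q^{p})\,Q(q^{bn},q^{p})=\sum_{t=-\infty}^{\infty}a_t q^t . \] Let $w$ be an integer with $2w\equiv m+n \pmod p$, and let $\bar m,\bar n$ be integers with $m\bar m\equiv n\bar n\equiv 1\pmod p$. If $p\equiv 1\pmod{12}$, then \[ a_{pt+bw}=a_{pt+b(w-3b)}=0 \qquad\text{for all } t\in\mathbb{Z}, \] and if $p\equiv 5\pmod{12}$, then \[ a_{pt+bw(1-3b\bar m)}=a_{pt+bw(1-3b\bar n)}=0 \qquad\text{for all } t\in\mathbb{Z}. \]
   Context: For complex $z\neq 0$ and $0<|q|<1$: $(z;q)_\infty=\prod_{j\ge 0}(1-zq^j)$, $(a_1,\dots,a_j;q)_\infty=(a_1;q)_\infty\cdots(a_j;q)_\infty$, and the quintuple product is $Q(z,q)=(z,q/z,q;q)_\infty\,(qz^2,q/z^2;q^2)_\infty$. Equivalently $Q(z,q)=\sum_{k\in\mathbb{Z}}q^{k(3k-1)/2}z^{3k}(1-zq^k)$, so $Q(q^x,q^p)$ for integers $x$ is a Laurent series in $q$ with integer coefficients. -}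

module Defs where

open import Data.Nat using (ℕ; zero; suc; _≤_)
open import Data.Integer using (ℤ; +_; -_; _+_; _-_; _*_; 0ℤ; 1ℤ; -1ℤ)
open import Data.List using (List; map; upTo; foldr; concatMap)
open import Data.Product using (∃; _×_)
open import Relation.Binary.PropositionalEquality using (_≡_)
open import Relation.Nullary.Decidable using (does)
open import Data.Bool using (if_then_else_)

range : ℕ → List ℤ
range N = map (λ i → (+ i) - (+ N)) (upTo (suc (N Data.Nat.+ N)))

sumℤ : List ℤ → ℤ
sumℤ = foldr _+_ 0ℤ

-- By the (stated) series form of the quintuple product,
--   Q(q^x, q^p) = Σ_{k∈ℤ} ( q^{E₀(x,p,k)} - q^{E₁(x,p,k)} )  with
--   E₀(x,p,k) = p·k(3k-1)/2 + 3kx,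
--   E₁(x,p,k) = p·k(3k-1)/2 + 3kx + x + pk = p·k(3k+1)/2 + 3kx + x.
-- To avoid division by 2 we use the doubled exponents 2·E₀ and 2·E₁.
twiceE₀ : ℤ → ℤ → ℤ → ℤ
twiceE₀ x p k = p * (k * ((+ 3) * k - 1ℤ)) + (+ 6) * k * x

twiceE₁ : ℤ → ℤ → ℤ → ℤ
twiceE₁ x p k = twiceE₀ x p k + (+ 2) * x + (+ 2) * p * k

-- Contribution of the pair of summation indices (k, l) of the two factors
-- Q(q^x, q^p) · Q(q^y, q^p) to the coefficient of q^t: each factor
-- contributes +q^{E₀} or -q^{E₁}.
pairCoeff : ℤ → ℤ → ℤ → ℤ → ℤ → ℤ → ℤ
pairCoeff x y p t k l =
    (if does (Data.Integer._≟_ (twiceE₀ x p k + twiceE₀ y p l) ((+ 2) * t)) then 1ℤ else 0ℤ)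
  - (if does (Data.Integer._≟_ (twiceE₀ x p k + twiceE₁ y p l) ((+ 2) * t)) then 1ℤ else 0ℤ)
  - (if does (Data.Integer._≟_ (twiceE₁ x p k + twiceE₀ y p l) ((+ 2) * t)) then 1ℤ else 0ℤ)
  + (if does (Data.Integer._≟_ (twiceE₁ x p k + twiceE₁ y p l) ((+ 2) * t)) then 1ℤ else 0ℤ)

truncCoeff : ℤ → ℤ → ℤ → ℕ → ℤ → ℤ
truncCoeff x y p N t =
  sumℤ (map (λ k → sumℤ (map (λ l → pairCoeff x y p t k l) (range N))) (range N))

-- The coefficient a_t of q^t in Q(q^x,q^p)·Q(q^y,q^p) (p > 0) is the
-- eventual (stable) value of the truncations; "a_t = 0" means:
CoeffZero : ℤ → ℤ → ℤ → ℤ → Set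
CoeffZero x y p t = ∃ λ N₀ → ∀ N → N₀ ≤ N → truncCoeff x y p N t ≡ 0ℤ

{-# OPTIONS --safe #-}
-- Write the terms of Q(q^x, q^p) as ±q^E with 24E = p(s² − 1) + 12x(s + 1), where s = 6k ∓ 1
-- runs over the integers prime to 6 and the sign is + exactly when 3 ∣ s + 1.  Then a_t is a
-- signed count of the pairs (s₁, s₂) with p(s₁² + s₂² − 2) + 12bm(s₁ + 1) + 12bn(s₂ + 1) = 24t,
-- i.e. of the Gaussian integers w = p(s₁ + s₂i) + 6bπ, π = m + ni, of a fixed norm.  For a
-- Gaussian integer ρ of norm p, w ↦ ρπw̄/p preserves that norm and is an involution; for
-- ρ = π, −π, −iπ, iπ and t in the classes of the theorem the congruence carried by the norm
-- equation makes it send solutions to solutions, and working modulo 3 shows that it reverses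
-- the sign, so the signed count vanishes.  When p ∣ b the reflection with ρ = −π̄ works for all t.
module Submission where

open import Defs
open import Data.Nat using (ℕ; _%_)
open import Data.Nat.Primality using (Prime)
open import Data.Integer using (ℤ; +_; _+_; _-_; _*_; 1ℤ)
open import Data.Integer.Divisibility using (_∣_)
open import Data.Product using (_×_)
open import Relation.Binary.PropositionalEquality using (_≡_)

open import Data.Bool using (Bool; true; false; if_then_else_)
open import Data.Empty using (⊥)
open import Data.Nat as ℕ using (zero; suc; NonZero; _/_)
import Data.Nat.Properties as ℕ
import Data.Nat.Divisibility as ℕ
import Data.Nat.DivMod as ℕ
open import Data.Nat.Primality using (prime?; prime[2]; ¬prime[1]; prime⇒irreducible; prime⇒nonZero; euclidsLemma)
open import Data.Integer using (-[1+_]; -_; 0ℤ; -1ℤ; ∣_∣; _≟_; _/ℕ_; _%ℕ_)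
open import Data.Integer.DivMod using (a≡a%ℕn+[a/ℕn]*n; n%ℕd<d)
open import Data.Integer.Properties
  using (+-identityˡ; +-assoc; +-comm; *-comm; *-assoc; *-identityˡ; *-identityʳ; *-zeroʳ; *-distribˡ-+;
         *-cancelˡ-≡; *-cancelʳ-≡; +-injective; abs-*; ∣i-j∣≤∣i∣+∣j∣; pos-+; pos-*;
         +-0-abelianGroup)
-- The development uses the signed divisibility _∣′_, which comes with the closure lemmas;
-- the statement is phrased with the unsigned _∣_.
open import Data.Integer.Divisibility.Signed
  using (divides; ∣ᵤ⇒∣; ∣⇒∣ᵤ; ∣-refl; ∣-trans; ∣m∣n⇒∣m+n; ∣m∣n⇒∣m-n; ∣m⇒∣m*n; ∣n⇒∣m*n)
  renaming (_∣_ to _∣′_; _∣?_ to _∣′?_)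
open import Algebra.Properties.AbelianGroup +-0-abelianGroup using () renaming (∙-cancelʳ to +-cancelʳ)
open import Data.Integer.Tactic.RingSolver using (solve-∀)
open import Data.List using (List; []; _∷_; map; _++_; length; cartesianProduct)
open import Data.List.Properties using (map-++; map-∘)
open import Data.List.Membership.Propositional using (_∈_; _∉_)
open import Data.List.Membership.Propositional.Properties
  using (∈-∃++; ∈-++⁻; ∈-++⁺ˡ; ∈-++⁺ʳ; ∈-map⁺; ∈-cartesianProduct⁺; ∈-upTo⁺)
open import Data.List.Relation.Binary.Permutation.Propositional using (↭⇒↭ₛ)
open import Data.List.Relation.Binary.Permutation.Propositional.Properties using (shift; ↭-length)
open import Data.List.Relation.Unary.All using ([]; _∷_)
open import Data.List.Relation.Unary.AllPairs as AllPairs using ([]; _∷_)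
open import Data.List.Relation.Unary.Any using (here; there)
open import Data.List.Relation.Unary.Unique.Propositional using (Unique)
open import Data.List.Relation.Unary.Unique.Propositional.Properties
  using (Unique[x∷xs]⇒x∉xs; map⁺; cartesianProduct⁺; upTo⁺)
open import Data.Product using (_,_; proj₁; proj₂; ∃-syntax)
open import Data.Sum using (_⊎_; inj₁; inj₂; [_,_]′)
open import Function using (_∘_)
open import Relation.Binary.PropositionalEquality
  using (refl; sym; trans; cong; cong₂; subst; _≢_; setoid; module ≡-Reasoning)
open import Relation.Nullary using (¬_; Dec; yes; no; does; contradiction)
open import Relation.Nullary.Decidable using (dec-true; dec-false; from-yes; from-no)

-- Sums of integer lists

private
  variable
    A B : Set

sumℤ-++ : ∀ xs ys → sumℤ (xs ++ ys) ≡ sumℤ xs + sumℤ ys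
sumℤ-++ []       ys = sym (+-identityˡ _)
sumℤ-++ (x ∷ xs) ys = trans (cong (_+_ x) (sumℤ-++ xs ys)) (sym (+-assoc x _ _))

sumℤ-map-+ : ∀ (f g : A → ℤ) xs →
  sumℤ (map (λ a → f a + g a) xs) ≡ sumℤ (map f xs) + sumℤ (map g xs)
sumℤ-map-+ f g []       = refl
sumℤ-map-+ f g (x ∷ xs) =
  trans (cong (_+_ (f x + g x)) (sumℤ-map-+ f g xs)) (interchange (f x) (g x) (sumℤ (map f xs)) (sumℤ (map g xs)))
  where
  interchange : ∀ a b c d → (a + b) + (c + d) ≡ (a + c) + (b + d)
  interchange = solve-∀

sumℤ-cong : ∀ {f g : A → ℤ} → (∀ a → f a ≡ g a) → ∀ xs → sumℤ (map f xs) ≡ sumℤ (map g xs)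
sumℤ-cong f≗g []       = refl
sumℤ-cong f≗g (x ∷ xs) = cong₂ _+_ (f≗g x) (sumℤ-cong f≗g xs)

sumℤ-swap : ∀ (f : A → B → ℤ) xs ys →
  sumℤ (map (λ a → sumℤ (map (f a) ys)) xs) ≡ sumℤ (map (λ b → sumℤ (map (λ a → f a b) xs)) ys)
sumℤ-swap f []       ys = sym (sumℤ-zero ys)
  where
  sumℤ-zero : ∀ ys → sumℤ (map (λ (_ : B) → 0ℤ) ys) ≡ 0ℤ
  sumℤ-zero []       = refl
  sumℤ-zero (_ ∷ ys) = trans (+-identityˡ _) (sumℤ-zero ys)
sumℤ-swap f (x ∷ xs) ys =
  trans (cong (_+_ (sumℤ (map (f x) ys))) (sumℤ-swap f xs ys))
        (sym (sumℤ-map-+ (f x) (λ b → sumℤ (map (λ a → f a b) xs)) ys))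

sumℤ-cartesianProduct : ∀ (f : A × B → ℤ) xs ys →
  sumℤ (map f (cartesianProduct xs ys)) ≡ sumℤ (map (λ a → sumℤ (map (λ b → f (a , b)) ys)) xs)
sumℤ-cartesianProduct f []       ys = refl
sumℤ-cartesianProduct f (x ∷ xs) ys = begin
  sumℤ (map f (map (x ,_) ys ++ cartesianProduct xs ys))
    ≡⟨ cong sumℤ (map-++ f (map (x ,_) ys) _) ⟩
  sumℤ (map f (map (x ,_) ys) ++ map f (cartesianProduct xs ys))
    ≡⟨ sumℤ-++ (map f (map (x ,_) ys)) _ ⟩
  sumℤ (map f (map (x ,_) ys)) + sumℤ (map f (cartesianProduct xs ys))
    ≡⟨ cong₂ _+_ (cong sumℤ (sym (map-∘ ys))) (sumℤ-cartesianProduct f xs ys) ⟩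
  sumℤ (map (λ b → f (x , b)) ys) + sumℤ (map (λ a → sumℤ (map (λ b → f (a , b)) ys)) xs) ∎
  where open ≡-Reasoning

sumℤ-shift : ∀ (h : A → ℤ) ys {v zs} → sumℤ (map h (ys ++ v ∷ zs)) ≡ h v + sumℤ (map h (ys ++ zs))
sumℤ-shift h []       = refl
sumℤ-shift h (y ∷ ys) {v} {zs} =
  trans (cong (_+_ (h y)) (sumℤ-shift h ys)) (swap-front (h y) (h v) (sumℤ (map h (ys ++ zs))))
  where
  swap-front : ∀ a b c → a + (b + c) ≡ b + (a + c)
  swap-front = solve-∀

∈-insert-mid : ∀ {a v : A} ys {zs} → a ∈ ys ++ zs → a ∈ ys ++ v ∷ zs
∈-insert-mid ys a∈ with ∈-++⁻ ys a∈
... | inj₁ a∈ys = ∈-++⁺ˡ a∈ys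
... | inj₂ a∈zs = ∈-++⁺ʳ ys (there a∈zs)

∈-remove-mid : ∀ {a v : A} ys {zs} → a ∈ ys ++ v ∷ zs → a ≢ v → a ∈ ys ++ zs
∈-remove-mid ys a∈ a≢v with ∈-++⁻ ys a∈
... | inj₁ a∈ys         = ∈-++⁺ˡ a∈ys
... | inj₂ (here a≡v)   = contradiction a≡v a≢v
... | inj₂ (there a∈zs) = ∈-++⁺ʳ ys a∈zs

module _ (h : A → ℤ) (σ : A → A)
         (σ-involutive : ∀ {a} → h a ≢ 0ℤ → σ (σ a) ≡ a)
         (σ-reverses : ∀ {a} → h a ≢ 0ℤ → h (σ a) ≡ - h a) where

  open import Data.List.Relation.Binary.Permutation.Setoid.Properties (setoid A) using (Unique-resp-↭)

  private
    σ-moves : ∀ {a} → h a ≢ 0ℤ → σ a ≢ a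
    σ-moves {a} ha≢0 σa≡a = ha≢0 (self-negative (trans (cong h (sym σa≡a)) (σ-reverses ha≢0)))
      where
      self-negative : ∀ {z} → z ≡ - z → z ≡ 0ℤ
      self-negative {+ zero} _ = refl

    σ-support : ∀ {a} → h a ≢ 0ℤ → h (σ a) ≢ 0ℤ
    σ-support ha≢0 hσa≡0 = ha≢0 (-z≡0⇒z≡0 (trans (sym (σ-reverses ha≢0)) hσa≡0))
      where
      -z≡0⇒z≡0 : ∀ {z} → - z ≡ 0ℤ → z ≡ 0ℤ
      -z≡0⇒z≡0 {+ zero} _ = refl

    sum≡0 : ∀ n L → length L ℕ.≤ n → Unique L → (∀ {a} → a ∈ L → h a ≢ 0ℤ → σ a ∈ L) →
            sumℤ (map h L) ≡ 0ℤ
    sum≡0 _       []       _           _               _      = refl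
    sum≡0 (suc n) (x ∷ xs) (ℕ.s≤s len) !x∷xs@(_ ∷ !xs) closed with h x ≟ 0ℤ
    ... | yes hx≡0 = cong₂ _+_ hx≡0 (sum≡0 n xs len !xs closed′)
      where
      closed′ : ∀ {a} → a ∈ xs → h a ≢ 0ℤ → σ a ∈ xs
      closed′ a∈xs ha≢0 with closed (there a∈xs) ha≢0
      ... | here σa≡x   = contradiction (trans (cong h σa≡x) hx≡0) (σ-support ha≢0)
      ... | there σa∈xs = σa∈xs
    ... | no hx≢0 with closed (here refl) hx≢0
    ...   | here σx≡x   = contradiction σx≡x (σ-moves hx≢0)
    ...   | there σx∈xs with ∈-∃++ σx∈xs
    ...     | ys , zs , refl = begin
        h x + sumℤ (map h (ys ++ σ x ∷ zs))       ≡⟨ cong (_+_ (h x)) (sumℤ-shift h ys) ⟩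
        h x + (h (σ x) + sumℤ (map h (ys ++ zs))) ≡⟨ cong (λ z → h x + (z + _)) (σ-reverses hx≢0) ⟩
        h x + (- h x + sumℤ (map h (ys ++ zs)))   ≡⟨ cancel (h x) _ ⟩
        sumℤ (map h (ys ++ zs))                   ≡⟨ sum≡0 n (ys ++ zs) len′ !rest closed′ ⟩
        0ℤ                                        ∎
      where
      open ≡-Reasoning
      cancel : ∀ a b → a + (- a + b) ≡ b
      cancel = solve-∀
      len′ : length (ys ++ zs) ℕ.≤ n
      len′ = ℕ.<⇒≤ (subst (ℕ._≤ n) (↭-length (shift (σ x) ys zs)) len)
      !σx∷rest : Unique (σ x ∷ ys ++ zs)
      !σx∷rest = Unique-resp-↭ (↭⇒↭ₛ (shift (σ x) ys zs)) !xs
      !rest : Unique (ys ++ zs)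
      !rest = AllPairs.tail !σx∷rest
      x∉rest : x ∉ ys ++ zs
      x∉rest = Unique[x∷xs]⇒x∉xs !x∷xs ∘ ∈-insert-mid ys
      closed′ : ∀ {a} → a ∈ ys ++ zs → h a ≢ 0ℤ → σ a ∈ ys ++ zs
      closed′ {a} a∈rest ha≢0 with closed (there (∈-insert-mid ys a∈rest)) ha≢0
      ... | here σa≡x = contradiction (subst (_∈ ys ++ zs) (trans (sym (σ-involutive ha≢0)) (cong σ σa≡x)) a∈rest)
                                      (Unique[x∷xs]⇒x∉xs !σx∷rest)
      ... | there σa∈ = ∈-remove-mid ys σa∈ λ σa≡σx → x∉rest (subst (_∈ ys ++ zs)
                          (trans (sym (σ-involutive ha≢0)) (trans (cong σ σa≡σx) (σ-involutive hx≢0))) a∈rest)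

  sumℤ-involution≡0 : ∀ L → Unique L → (∀ {a} → a ∈ L → h a ≢ 0ℤ → σ a ∈ L) →
                      sumℤ (map h L) ≡ 0ℤ
  sumℤ-involution≡0 L = sum≡0 (length L) L ℕ.≤-refl

-- Divisibility and residues

prime[3] : Prime 3
prime[3] = from-yes (prime? 3)

¬3∣1 : ¬ + 3 ∣′ 1ℤ
¬3∣1 = from-no (+ 3 ∣′? 1ℤ)

¬3∣2 : ¬ + 3 ∣′ + 2
¬3∣2 = from-no (+ 3 ∣′? + 2)

¬4∣1 : ¬ + 4 ∣′ 1ℤ
¬4∣1 = from-no (+ 4 ∣′? 1ℤ)

¬4∣2 : ¬ + 4 ∣′ + 2
¬4∣2 = from-no (+ 4 ∣′? + 2)

euclidsLemmaℤ : ∀ {p} a b → Prime p → + p ∣′ a * b → + p ∣′ a ⊎ + p ∣′ b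
euclidsLemmaℤ a b p-prime p∣ab
  with euclidsLemma ∣ a ∣ ∣ b ∣ p-prime (subst (_ ℕ.∣_) (abs-* a b) (∣⇒∣ᵤ p∣ab))
... | inj₁ p∣a = inj₁ (∣ᵤ⇒∣ p∣a)
... | inj₂ p∣b = inj₂ (∣ᵤ⇒∣ p∣b)

prime∣*-cancelˡ : ∀ {p a b} → Prime p → ¬ + p ∣′ a → + p ∣′ a * b → + p ∣′ b
prime∣*-cancelˡ {a = a} {b} p-prime p∤a p∣ab with euclidsLemmaℤ a b p-prime p∣ab
... | inj₁ p∣a = contradiction p∣a p∤a
... | inj₂ p∣b = p∣b

residue3 : ∀ z → + 3 ∣′ z ⊎ + 3 ∣′ z - 1ℤ ⊎ + 3 ∣′ z + 1ℤ
residue3 z = go (z /ℕ 3) (z %ℕ 3) (n%ℕd<d z 3) (a≡a%ℕn+[a/ℕn]*n z 3)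
  where
  go : ∀ q r → r ℕ.< 3 → z ≡ + r + q * + 3 → + 3 ∣′ z ⊎ + 3 ∣′ z - 1ℤ ⊎ + 3 ∣′ z + 1ℤ
  go q 0 _ refl = inj₁ (divides q (+-identityˡ _))
  go q 1 _ refl = inj₂ (inj₁ (divides q (lemma q)))
    where lemma : ∀ q → + 1 + q * + 3 - 1ℤ ≡ q * + 3
          lemma = solve-∀
  go q 2 _ refl = inj₂ (inj₂ (divides (q + 1ℤ) (lemma q)))
    where lemma : ∀ q → + 2 + q * + 3 + 1ℤ ≡ (q + 1ℤ) * + 3
          lemma = solve-∀
  go q (suc (suc (suc _))) (ℕ.s≤s (ℕ.s≤s (ℕ.s≤s ()))) _

square-residue3 : ∀ z → + 3 ∣′ z ⊎ + 3 ∣′ z * z - 1ℤ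
square-residue3 z with residue3 z
... | inj₁ 3∣z          = inj₁ 3∣z
... | inj₂ (inj₁ 3∣z-1) = inj₂ (subst (_ ∣′_) (lemma z) (∣m⇒∣m*n (z + 1ℤ) 3∣z-1))
  where lemma : ∀ z → (z - 1ℤ) * (z + 1ℤ) ≡ z * z - 1ℤ
        lemma = solve-∀
... | inj₂ (inj₂ 3∣z+1) = inj₂ (subst (_ ∣′_) (lemma z) (∣m⇒∣m*n (z - 1ℤ) 3∣z+1))
  where lemma : ∀ z → (z + 1ℤ) * (z - 1ℤ) ≡ z * z - 1ℤ
        lemma = solve-∀

square-residue2 : ∀ z → + 2 ∣′ z ⊎ + 4 ∣′ z * z - 1ℤ
square-residue2 z = go (z /ℕ 2) (z %ℕ 2) (n%ℕd<d z 2) (a≡a%ℕn+[a/ℕn]*n z 2)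
  where
  go : ∀ q r → r ℕ.< 2 → z ≡ + r + q * + 2 → + 2 ∣′ z ⊎ + 4 ∣′ z * z - 1ℤ
  go q 0 _ refl = inj₁ (divides q (+-identityˡ _))
  go q 1 _ refl = inj₂ (divides (q * q + q) (lemma q))
    where lemma : ∀ q → (+ 1 + q * + 2) * (+ 1 + q * + 2) - 1ℤ ≡ (q * q + q) * + 4
          lemma = solve-∀
  go q (suc (suc _)) (ℕ.s≤s (ℕ.s≤s ())) _

¬3∣square-2 : ∀ z → ¬ + 3 ∣′ z * z - + 2
¬3∣square-2 z 3∣z²-2 with square-residue3 z
... | inj₁ 3∣z      = ¬3∣2 (subst (_ ∣′_) (lemma z) (∣m∣n⇒∣m-n (∣m⇒∣m*n z 3∣z) 3∣z²-2))
  where lemma : ∀ z → z * z - (z * z - + 2) ≡ + 2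
        lemma = solve-∀
... | inj₂ 3∣z²-1 = ¬3∣1 (subst (_ ∣′_) (lemma z) (∣m∣n⇒∣m-n 3∣z²-1 3∣z²-2))
  where lemma : ∀ z → (z * z - 1ℤ) - (z * z - + 2) ≡ 1ℤ
        lemma = solve-∀

¬4∣square-2 : ∀ z → ¬ + 4 ∣′ z * z - + 2
¬4∣square-2 z 4∣z²-2 with square-residue2 z
... | inj₁ (divides a refl) = ¬4∣2 (subst (_ ∣′_) (lemma a) (∣m∣n⇒∣m-n (divides (a * a) refl) 4∣z²-2))
  where lemma : ∀ a → (a * a) * + 4 - (a * + 2 * (a * + 2) - + 2) ≡ + 2
        lemma = solve-∀
... | inj₂ 4∣z²-1 = ¬4∣1 (subst (_ ∣′_) (lemma z) (∣m∣n⇒∣m-n 4∣z²-1 4∣z²-2))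
  where lemma : ∀ z → (z * z - 1ℤ) - (z * z - + 2) ≡ 1ℤ
        lemma = solve-∀

/ℕ-exact : ∀ X p .{{_ : NonZero p}} → + p ∣′ X → X /ℕ p * + p ≡ X
/ℕ-exact X p p∣X = go (X %ℕ p) (n%ℕd<d X p) (a≡a%ℕn+[a/ℕn]*n X p)
  where
  q = X /ℕ p
  go : ∀ r → r ℕ.< p → X ≡ + r + q * + p → q * + p ≡ X
  go zero    _   X≡qp = sym (trans X≡qp (+-identityˡ _))
  go (suc r) r<p X≡r+qp = contradiction (ℕ.∣⇒≤ (∣⇒∣ᵤ p∣r+1)) (ℕ.<⇒≱ r<p)
    where
    lemma : ∀ a b → a + b - b ≡ a
    lemma = solve-∀
    p∣r+1 : + p ∣′ + suc r
    p∣r+1 = subst (_ ∣′_) (trans (cong (_- q * + p) X≡r+qp) (lemma (+ suc r) (q * + p)))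
                  (∣m∣n⇒∣m-n p∣X (divides q refl))

[p*z]/ℕp≡z : ∀ p .{{_ : NonZero p}} z → (+ p * z) /ℕ p ≡ z
[p*z]/ℕp≡z p z = *-cancelʳ-≡ _ z (+ p) (trans (/ℕ-exact (+ p * z) p (divides z (*-comm (+ p) z))) (*-comm (+ p) z))

2∣⇒4∣square : ∀ {z} → + 2 ∣′ z → + 4 ∣′ z * z
2∣⇒4∣square (divides a refl) = divides (a * a) (lemma a)
  where lemma : ∀ a → a * + 2 * (a * + 2) ≡ a * a * + 4
        lemma = solve-∀

∣sumOfSquares-2⇒∣square-2 : ∀ {q} a b → q ∣′ a * a + b * b - + 2 → q ∣′ a * a → q ∣′ b * b - + 2
∣sumOfSquares-2⇒∣square-2 a b q∣D q∣a² = subst (_ ∣′_) (lemma a b) (∣m∣n⇒∣m-n q∣D q∣a²)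
  where lemma : ∀ a b → a * a + b * b - + 2 - a * a ≡ b * b - + 2
        lemma = solve-∀

-- Squares are 0 or 1 modulo 3 and modulo 4, so a² + b² ≡ 2 forces a² ≡ b² ≡ 1.
3∤-of-sumOfSquares : ∀ a b → + 3 ∣′ a * a + b * b - + 2 → ¬ + 3 ∣′ a
3∤-of-sumOfSquares a b 3∣D 3∣a = ¬3∣square-2 b (∣sumOfSquares-2⇒∣square-2 a b 3∣D (∣m⇒∣m*n a 3∣a))

2∤-of-sumOfSquares : ∀ a b → + 4 ∣′ a * a + b * b - + 2 → ¬ + 2 ∣′ a
2∤-of-sumOfSquares a b 4∣D 2∣a = ¬4∣square-2 b (∣sumOfSquares-2⇒∣square-2 a b 4∣D (2∣⇒4∣square 2∣a))

%⇒∣ : ∀ p k .{{_ : NonZero k}} r → p % k ≡ r → + k ∣′ + p - + r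
%⇒∣ p k r p%k≡r = divides (+ (p / k)) (begin
  + p - + r
    ≡⟨ cong (λ z → + z - + r) (trans (ℕ.m≡m%n+[m/n]*n p k) (cong (ℕ._+ (p / k) ℕ.* k) p%k≡r)) ⟩
  + (r ℕ.+ p / k ℕ.* k) - + r
    ≡⟨ cong (_- + r) (trans (pos-+ r _) (cong (_+_ (+ r)) (pos-* (p / k) k))) ⟩
  + r + + (p / k) * + k - + r
    ≡⟨ lemma (+ r) (+ (p / k) * + k) ⟩
  + (p / k) * + k ∎)
  where
  open ≡-Reasoning
  lemma : ∀ a b → a + b - a ≡ b
  lemma = solve-∀

module _ {p} (p-prime : Prime p) (p≡1[4] : p % 4 ≡ 1) where

  private
    p≢ : ∀ {d} → p ≡ d → d % 4 ≢ 1 → ⊥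
    p≢ refl d%4≢1 = d%4≢1 p≡1[4]

  3∤p : ¬ + 3 ∣′ + p
  3∤p 3∣p with prime⇒irreducible p-prime (∣⇒∣ᵤ 3∣p)
  ... | inj₂ 3≡p = p≢ (sym 3≡p) (λ ())

  p∤prime : ∀ {d} → Prime d → d % 4 ≢ 1 → ¬ p ℕ.∣ d
  p∤prime d-prime d%4≢1 p∣d with prime⇒irreducible d-prime p∣d
  ... | inj₁ refl = ¬prime[1] p-prime
  ... | inj₂ p≡d  = p≢ p≡d d%4≢1

  p∤12 : ¬ + p ∣′ + 12
  p∤12 p∣12 with euclidsLemma 4 3 p-prime (∣⇒∣ᵤ p∣12)
  ... | inj₂ p∣3 = p∤prime prime[3] (λ ()) p∣3
  ... | inj₁ p∣4 with euclidsLemma 2 2 p-prime p∣4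
  ...   | inj₁ p∣2 = p∤prime prime[2] (λ ()) p∣2
  ...   | inj₂ p∣2 = p∤prime prime[2] (λ ()) p∣2

  p∤12* : ∀ {b} → ¬ + p ∣′ b → ¬ + p ∣′ + 12 * b
  p∤12* {b} p∤b p∣12b with euclidsLemmaℤ (+ 12) b p-prime p∣12b
  ... | inj₁ p∣12 = p∤12 p∣12
  ... | inj₂ p∣b  = p∤b p∣b

p∤summand : ∀ {p} m n → Prime p → + p ≡ m * m + n * n → ¬ + p ∣′ m
p∤summand {p} m n p-prime p≡m²+n² (divides a m≡ap) = [ p∤n , p∤n ]′ (euclidsLemmaℤ n n p-prime p∣n²)
  where
  p∣n² : + p ∣′ n * n
  p∣n² = divides (1ℤ - a * a * + p) (begin
    n * n                                               ≡⟨ lemma m n ⟩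
    (m * m + n * n) - m * m                             ≡⟨ cong₂ (λ q m → q - m * m) (sym p≡m²+n²) m≡ap ⟩
    + p - a * + p * (a * + p)                           ≡⟨ lemma′ a (+ p) ⟩
    (1ℤ - a * a * + p) * + p                            ∎)
    where
    open ≡-Reasoning
    lemma : ∀ m n → n * n ≡ (m * m + n * n) - m * m
    lemma = solve-∀
    lemma′ : ∀ a p → p - a * p * (a * p) ≡ (1ℤ - a * a * p) * p
    lemma′ = solve-∀
  p∤n : ¬ + p ∣′ n
  p∤n (divides c n≡cp) = ¬prime[1] (subst Prime p≡1 p-prime)
    where
    instance _ = prime⇒nonZero p-prime
    p≡1 : p ≡ 1
    p≡1 = ℕ.∣1⇒≡1 (∣⇒∣ᵤ (divides (a * a + c * c) (*-cancelʳ-≡ 1ℤ _ (+ p) (begin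
      1ℤ * + p                                  ≡⟨ *-identityˡ (+ p) ⟩
      + p                                       ≡⟨ p≡m²+n² ⟩
      m * m + n * n                             ≡⟨ cong₂ (λ m n → m * m + n * n) m≡ap n≡cp ⟩
      a * + p * (a * + p) + c * + p * (c * + p) ≡⟨ lemma a c (+ p) ⟩
      (a * a + c * c) * + p * + p               ∎))))
      where
      open ≡-Reasoning
      lemma : ∀ a c p → a * p * (a * p) + c * p * (c * p) ≡ (a * a + c * c) * p * p
      lemma = solve-∀

sumOfSquares≡1[3]⇒3∣* : ∀ m n → + 3 ∣′ m * m + n * n - 1ℤ → + 3 ∣′ m * n
sumOfSquares≡1[3]⇒3∣* m n 3∣m²+n²-1 with square-residue3 m | square-residue3 n
... | inj₁ 3∣m    | _            = ∣m⇒∣m*n n 3∣m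
... | inj₂ _      | inj₁ 3∣n     = ∣n⇒∣m*n m 3∣n
... | inj₂ 3∣m²-1 | inj₂ 3∣n²-1 =
  contradiction (subst (_ ∣′_) (lemma m n) (∣m∣n⇒∣m-n (∣m∣n⇒∣m-n 3∣m²+n²-1 3∣m²-1) 3∣n²-1)) ¬3∣1
  where lemma : ∀ m n → m * m + n * n - 1ℤ - (m * m - 1ℤ) - (n * n - 1ℤ) ≡ 1ℤ
        lemma = solve-∀

sumOfSquares≡2[3]⇒3∣square-1 : ∀ m n → + 3 ∣′ m * m + n * n - + 2 → + 3 ∣′ m * m - 1ℤ
sumOfSquares≡2[3]⇒3∣square-1 m n 3∣m²+n²-2 with square-residue3 m
... | inj₁ 3∣m    = contradiction 3∣m (3∤-of-sumOfSquares m n 3∣m²+n²-2)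
... | inj₂ 3∣m²-1 = 3∣m²-1

p≡1[12]⇒3∣mn : ∀ {p} m n → + p ≡ m * m + n * n → p % 12 ≡ 1 → + 3 ∣′ m * n
p≡1[12]⇒3∣mn {p} m n p≡m²+n² p≡1[12] = sumOfSquares≡1[3]⇒3∣* m n
  (subst (λ q → + 3 ∣′ q - 1ℤ) p≡m²+n² (∣-trans (divides (+ 4) refl) (%⇒∣ p 12 1 p≡1[12])))

p≡5[12]⇒3∣n²-m² : ∀ {p} m n → + p ≡ m * m + n * n → p % 12 ≡ 5 → + 3 ∣′ n * n - m * m
p≡5[12]⇒3∣n²-m² {p} m n p≡m²+n² p≡5[12] = subst (_ ∣′_) (lemma m n)
  (∣m∣n⇒∣m-n (sumOfSquares≡2[3]⇒3∣square-1 n m 3∣n²+m²-2) (sumOfSquares≡2[3]⇒3∣square-1 m n 3∣m²+n²-2))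
  where
  lemma : ∀ m n → n * n - 1ℤ - (m * m - 1ℤ) ≡ n * n - m * m
  lemma = solve-∀
  3∣m²+n²-2 : + 3 ∣′ m * m + n * n - + 2
  3∣m²+n²-2 = subst (_ ∣′_) (shift′ (m * m + n * n)) (∣m∣n⇒∣m+n
    (subst (λ q → + 3 ∣′ q - + 5) p≡m²+n² (∣-trans (divides (+ 4) refl) (%⇒∣ p 12 5 p≡5[12]))) (divides 1ℤ refl))
    where shift′ : ∀ a → a - + 5 + 1ℤ * + 3 ≡ a - + 2
          shift′ = solve-∀
  3∣n²+m²-2 : + 3 ∣′ n * n + m * m - + 2
  3∣n²+m²-2 = subst (λ q → + 3 ∣′ q - + 2) (+-comm (m * m) (n * n)) 3∣m²+n²-2

-- The coefficients as signed sums over exponent pairs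

-- The pair (k, true) stands for the term q^{E₀(x,P,k)} of Q(q^x, q^P) and (k, false) for −q^{E₁(x,P,k)};
-- both are encoded by s = 6k + ε i, for which 24 E = exponent x P s and the sign is −ε i.
ε : Bool → ℤ
ε true  = -1ℤ
ε false = 1ℤ

encode : ℤ × Bool → ℤ
encode (k , i) = + 6 * k + ε i

exponent : ℤ → ℤ → ℤ → ℤ
exponent x P s = P * (s * s - 1ℤ) + + 12 * x * (s + 1ℤ)

pairExponent : ℤ → ℤ → ℤ → ℤ × ℤ → ℤ
pairExponent x y P (s₁ , s₂) = exponent x P s₁ + exponent y P s₂

Solution : ℤ → ℤ → ℤ → ℤ → ℤ × ℤ → Set
Solution x y P t s = pairExponent x y P s ≡ + 24 * t

sign : ℤ × ℤ → ℤ
sign (s₁ , s₂) = if does (+ 3 ∣′? s₁ * s₂ - 1ℤ) then 1ℤ else -1ℤ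

contribution : ℤ → ℤ → ℤ → ℤ → ℤ × ℤ → ℤ
contribution x y P t s = if does (pairExponent x y P s ≟ + 24 * t) then sign s else 0ℤ

signs : List Bool
signs = true ∷ false ∷ []

indices : ℕ → List ℤ
indices N = map encode (cartesianProduct (range N) signs)

twiceE : Bool → ℤ → ℤ → ℤ → ℤ
twiceE true  = twiceE₀
twiceE false = twiceE₁

exponent-encode : ∀ x P k i → exponent x P (encode (k , i)) ≡ + 12 * twiceE i x P k
exponent-encode x P k true  = lemma x P k
  where lemma : ∀ x P k → P * ((+ 6 * k - 1ℤ) * (+ 6 * k - 1ℤ) - 1ℤ) + + 12 * x * ((+ 6 * k - 1ℤ) + 1ℤ)
                        ≡ + 12 * (P * (k * (+ 3 * k - 1ℤ)) + + 6 * k * x)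
        lemma = solve-∀
exponent-encode x P k false = lemma x P k
  where lemma : ∀ x P k → P * ((+ 6 * k + 1ℤ) * (+ 6 * k + 1ℤ) - 1ℤ) + + 12 * x * ((+ 6 * k + 1ℤ) + 1ℤ)
                        ≡ + 12 * ((P * (k * (+ 3 * k - 1ℤ)) + + 6 * k * x) + + 2 * x + + 2 * P * k)
        lemma = solve-∀

sign≡1 : ∀ {s₁ s₂} → + 3 ∣′ s₁ * s₂ - 1ℤ → sign (s₁ , s₂) ≡ 1ℤ
sign≡1 3∣ = cong (if_then 1ℤ else -1ℤ) (dec-true (+ 3 ∣′? _) 3∣)

sign≡-1 : ∀ {s₁ s₂} → + 3 ∣′ s₁ * s₂ + 1ℤ → sign (s₁ , s₂) ≡ -1ℤ
sign≡-1 {s₁} {s₂} 3∣ = cong (if_then 1ℤ else -1ℤ) (dec-false (+ 3 ∣′? _) λ 3∣′ →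
  ¬3∣2 (subst (_ ∣′_) (lemma (s₁ * s₂)) (∣m∣n⇒∣m-n 3∣ 3∣′)))
  where lemma : ∀ z → z + 1ℤ - (z - 1ℤ) ≡ + 2
        lemma = solve-∀

3∣encode*encode-ε*ε : ∀ k i l j → + 3 ∣′ encode (k , i) * encode (l , j) - ε i * ε j
3∣encode*encode-ε*ε k i l j = divides (+ 12 * k * l + + 2 * k * ε j + + 2 * l * ε i) (lemma k l (ε i) (ε j))
  where lemma : ∀ k l a c → (+ 6 * k + a) * (+ 6 * l + c) - a * c ≡ (+ 12 * k * l + + 2 * k * c + + 2 * l * a) * + 3
        lemma = solve-∀

sign-encode : ∀ k i l j → sign (encode (k , i) , encode (l , j)) ≡ ε i * ε j
sign-encode k true  l true  = sign≡1  {encode (k , true)}  {encode (l , true)}  (3∣encode*encode-ε*ε k true  l true)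
sign-encode k true  l false = sign≡-1 {encode (k , true)}  {encode (l , false)} (3∣encode*encode-ε*ε k true  l false)
sign-encode k false l true  = sign≡-1 {encode (k , false)} {encode (l , true)}  (3∣encode*encode-ε*ε k false l true)
sign-encode k false l false = sign≡1  {encode (k , false)} {encode (l , false)} (3∣encode*encode-ε*ε k false l false)

does-*-≟ : ∀ c .{{_ : Data.Integer.NonZero c}} a b → does (c * a ≟ c * b) ≡ does (a ≟ b)
does-*-≟ c a b with c * a ≟ c * b | a ≟ b
... | yes ca≡cb | no a≢b  = contradiction (*-cancelˡ-≡ c a b ca≡cb) a≢b
... | no ca≢cb  | yes a≡b = contradiction (cong (c *_) a≡b) ca≢cb
... | yes _     | yes _   = refl
... | no _      | no _    = refl

indicator : ∀ {A : Set} → Dec A → ℤ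
indicator a? = if does a? then 1ℤ else 0ℤ

contribution-encode : ∀ x y P t k i l j →
  contribution x y P t (encode (k , i) , encode (l , j))
    ≡ ε i * ε j * indicator (twiceE i x P k + twiceE j y P l ≟ + 2 * t)
contribution-encode x y P t k i l j = begin
  (if does (exponent x P (encode (k , i)) + exponent y P (encode (l , j)) ≟ + 24 * t)
     then sign (encode (k , i) , encode (l , j)) else 0ℤ)
    ≡⟨ cong₂ (λ b v → if b then v else 0ℤ) does-equation (sign-encode k i l j) ⟩
  (if does (twiceE i x P k + twiceE j y P l ≟ + 2 * t) then ε i * ε j else 0ℤ)
    ≡⟨ if-scale (does (twiceE i x P k + twiceE j y P l ≟ + 2 * t)) ⟩
  ε i * ε j * indicator (twiceE i x P k + twiceE j y P l ≟ + 2 * t) ∎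
  where
  open ≡-Reasoning
  u = twiceE i x P k
  v = twiceE j y P l
  24t≡12[2t] : + 24 * t ≡ + 12 * (+ 2 * t)
  24t≡12[2t] = lemma t
    where lemma : ∀ t → + 24 * t ≡ + 12 * (+ 2 * t)
          lemma = solve-∀
  does-equation : does (exponent x P (encode (k , i)) + exponent y P (encode (l , j)) ≟ + 24 * t)
                ≡ does (u + v ≟ + 2 * t)
  does-equation = trans (cong₂ (λ a b → does (a ≟ b))
                                (trans (cong₂ _+_ (exponent-encode x P k i) (exponent-encode y P l j))
                                       (sym (*-distribˡ-+ (+ 12) u v)))
                                24t≡12[2t])
                        (does-*-≟ (+ 12) (u + v) (+ 2 * t))
  if-scale : ∀ b → (if b then ε i * ε j else 0ℤ) ≡ ε i * ε j * (if b then 1ℤ else 0ℤ)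
  if-scale true  = sym (*-identityʳ (ε i * ε j))
  if-scale false = sym (*-zeroʳ (ε i * ε j))

pairCoeff-as-sum : ∀ x y P t k l →
  sumℤ (map (λ i → sumℤ (map (λ j → contribution x y P t (encode (k , i) , encode (l , j))) signs)) signs)
    ≡ pairCoeff x y P t k l
pairCoeff-as-sum x y P t k l = begin
  (c true true + (c true false + 0ℤ)) + ((c false true + (c false false + 0ℤ)) + 0ℤ)
    ≡⟨ cong₂ _+_ (cong₂ (λ a b → a + (b + 0ℤ)) (contribution-encode x y P t k true l true)
                                              (contribution-encode x y P t k true l false))
                 (cong₂ (λ a b → (a + (b + 0ℤ)) + 0ℤ) (contribution-encode x y P t k false l true)
                                                     (contribution-encode x y P t k false l false)) ⟩
  (1ℤ * I true true + (-1ℤ * I true false + 0ℤ)) + ((-1ℤ * I false true + (1ℤ * I false false + 0ℤ)) + 0ℤ)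
    ≡⟨ expand (I true true) (I true false) (I false true) (I false false) ⟩
  I true true - I true false - I false true + I false false ∎
  where
  open ≡-Reasoning
  c : Bool → Bool → ℤ
  c i j = contribution x y P t (encode (k , i) , encode (l , j))
  I : Bool → Bool → ℤ
  I i j = indicator (twiceE i x P k + twiceE j y P l ≟ + 2 * t)
  expand : ∀ a b c d → (1ℤ * a + (-1ℤ * b + 0ℤ)) + ((-1ℤ * c + (1ℤ * d + 0ℤ)) + 0ℤ) ≡ a - b - c + d
  expand = solve-∀

sumℤ-indices : ∀ (g : ℤ → ℤ) N →
  sumℤ (map g (indices N)) ≡ sumℤ (map (λ k → sumℤ (map (λ i → g (encode (k , i))) signs)) (range N))
sumℤ-indices g N = trans (cong sumℤ (sym (map-∘ {g = g} {f = encode} (cartesianProduct (range N) signs))))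
                         (sumℤ-cartesianProduct (λ ki → g (encode ki)) (range N) signs)

truncCoeff-as-sum : ∀ x y P N t →
  truncCoeff x y P N t ≡ sumℤ (map (contribution x y P t) (cartesianProduct (indices N) (indices N)))
truncCoeff-as-sum x y P N t = sym (begin
  sumℤ (map c (cartesianProduct (indices N) (indices N)))
    ≡⟨ sumℤ-cartesianProduct c (indices N) (indices N) ⟩
  sumℤ (map (λ a → sumℤ (map (λ b → c (a , b)) (indices N))) (indices N))
    ≡⟨ sumℤ-cong (λ a → sumℤ-indices (λ b → c (a , b)) N) (indices N) ⟩
  sumℤ (map (λ a → Σₗ λ l → Σⱼ λ j → c (a , encode (l , j))) (indices N))
    ≡⟨ sumℤ-indices (λ a → Σₗ λ l → Σⱼ λ j → c (a , encode (l , j))) N ⟩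
  Σₖ (λ k → Σᵢ λ i → Σₗ λ l → Σⱼ λ j → c (encode (k , i) , encode (l , j)))
    ≡⟨ sumℤ-cong (λ k → sumℤ-swap (λ i l → Σⱼ λ j → c (encode (k , i) , encode (l , j))) signs (range N))
                 (range N) ⟩
  Σₖ (λ k → Σₗ λ l → Σᵢ λ i → Σⱼ λ j → c (encode (k , i) , encode (l , j)))
    ≡⟨ sumℤ-cong (λ k → sumℤ-cong (pairCoeff-as-sum x y P t k) (range N)) (range N) ⟩
  truncCoeff x y P N t ∎)
  where
  open ≡-Reasoning
  c = contribution x y P t
  Σₖ Σₗ : (ℤ → ℤ) → ℤ
  Σₖ f = sumℤ (map f (range N))
  Σₗ f = sumℤ (map f (range N))
  Σᵢ Σⱼ : (Bool → ℤ) → ℤ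
  Σᵢ f = sumℤ (map f signs)
  Σⱼ f = sumℤ (map f signs)

-- The solutions of the exponent equation

CoprimeTo6 : ℤ → Set
CoprimeTo6 s = ¬ + 2 ∣′ s × ¬ + 3 ∣′ s

solution⇒coprimeTo6 : ∀ {x y P t s₁ s₂} → + 4 ∣′ P - 1ℤ → ¬ + 3 ∣′ P →
  Solution x y P t (s₁ , s₂) → CoprimeTo6 s₁ × CoprimeTo6 s₂
solution⇒coprimeTo6 {x} {y} {P} {t} {s₁} {s₂} 4∣P-1 3∤P solution =
    (2∤-of-sumOfSquares s₁ s₂ 4∣D , 3∤-of-sumOfSquares s₁ s₂ 3∣D)
  , (2∤-of-sumOfSquares s₂ s₁ (swap 4∣D) , 3∤-of-sumOfSquares s₂ s₁ (swap 3∣D))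
  where
  D = s₁ * s₁ + s₂ * s₂ - + 2
  12∣PD : + 12 ∣′ P * D
  12∣PD = divides (+ 2 * t - x * (s₁ + 1ℤ) - y * (s₂ + 1ℤ)) (begin
    P * D                                                     ≡⟨ split x y P s₁ s₂ ⟩
    pairExponent x y P (s₁ , s₂) - + 12 * (x * (s₁ + 1ℤ) + y * (s₂ + 1ℤ))
                                                              ≡⟨ cong (_- + 12 * (x * (s₁ + 1ℤ) + y * (s₂ + 1ℤ))) solution ⟩
    + 24 * t - + 12 * (x * (s₁ + 1ℤ) + y * (s₂ + 1ℤ))         ≡⟨ factor x y t s₁ s₂ ⟩
    (+ 2 * t - x * (s₁ + 1ℤ) - y * (s₂ + 1ℤ)) * + 12          ∎)
    where
    open ≡-Reasoning
    split : ∀ x y P s₁ s₂ → P * (s₁ * s₁ + s₂ * s₂ - + 2)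
                          ≡ (P * (s₁ * s₁ - 1ℤ) + + 12 * x * (s₁ + 1ℤ)) + (P * (s₂ * s₂ - 1ℤ) + + 12 * y * (s₂ + 1ℤ))
                            - + 12 * (x * (s₁ + 1ℤ) + y * (s₂ + 1ℤ))
    split = solve-∀
    factor : ∀ x y t s₁ s₂ → + 24 * t - + 12 * (x * (s₁ + 1ℤ) + y * (s₂ + 1ℤ))
                           ≡ (+ 2 * t - x * (s₁ + 1ℤ) - y * (s₂ + 1ℤ)) * + 12
    factor = solve-∀
  3∣D : + 3 ∣′ D
  3∣D = prime∣*-cancelˡ prime[3] 3∤P (∣-trans (divides (+ 4) refl) 12∣PD)
  4∣D : + 4 ∣′ D
  4∣D = subst (_ ∣′_) (lemma P D) (∣m∣n⇒∣m-n (∣-trans (divides (+ 3) refl) 12∣PD) (∣m⇒∣m*n D 4∣P-1))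
    where lemma : ∀ P D → P * D - (P - 1ℤ) * D ≡ D
          lemma = solve-∀
  swap : ∀ {q} → q ∣′ D → q ∣′ s₂ * s₂ + s₁ * s₁ - + 2
  swap = subst (_ ∣′_) (lemma s₁ s₂)
    where lemma : ∀ a b → a * a + b * b - + 2 ≡ b * b + a * a - + 2
          lemma = solve-∀

‖_‖² : ℤ × ℤ → ℤ
‖ (a , b) ‖² = a * a + b * b

centred : ℤ → ℤ → ℤ → ℤ × ℤ → ℤ × ℤ
centred x y P (s₁ , s₂) = (P * s₁ + + 6 * x , P * s₂ + + 6 * y)

pairExponent-centred : ∀ x y P s →
  P * pairExponent x y P s + ‖ (P - + 6 * x , P - + 6 * y) ‖² ≡ ‖ centred x y P s ‖²
pairExponent-centred x y P (s₁ , s₂) = lemma x y P s₁ s₂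
  where
  lemma : ∀ x y P s₁ s₂ →
    P * ((P * (s₁ * s₁ - 1ℤ) + + 12 * x * (s₁ + 1ℤ)) + (P * (s₂ * s₂ - 1ℤ) + + 12 * y * (s₂ + 1ℤ)))
      + ((P - + 6 * x) * (P - + 6 * x) + (P - + 6 * y) * (P - + 6 * y))
    ≡ (P * s₁ + + 6 * x) * (P * s₁ + + 6 * x) + (P * s₂ + + 6 * y) * (P * s₂ + + 6 * y)
  lemma = solve-∀

solutionNorm : ℤ → ℤ → ℤ → ℤ → ℤ
solutionNorm x y P t = P * (+ 24 * t) + ‖ (P - + 6 * x , P - + 6 * y) ‖²

solution⇒norm : ∀ {x y P t} s → Solution x y P t s → ‖ centred x y P s ‖² ≡ solutionNorm x y P t
solution⇒norm {x} {y} {P} s solution =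
  trans (sym (pairExponent-centred x y P s)) (cong (λ e → P * e + ‖ (P - + 6 * x , P - + 6 * y) ‖²) solution)

∣a∣≤‖a,b‖² : ∀ a b → ∣ a ∣ ℕ.≤ ∣ ‖ (a , b) ‖² ∣
∣a∣≤‖a,b‖² a b = begin
  ∣ a ∣                           ≤⟨ n≤n*n ∣ a ∣ ⟩
  ∣ a ∣ ℕ.* ∣ a ∣                 ≤⟨ ℕ.m≤m+n _ _ ⟩
  ∣ a ∣ ℕ.* ∣ a ∣ ℕ.+ ∣ b ∣ ℕ.* ∣ b ∣ ≡⟨ cong ∣_∣ (pos-+ (∣ a ∣ ℕ.* ∣ a ∣) _) ⟩
  ∣ + (∣ a ∣ ℕ.* ∣ a ∣) + + (∣ b ∣ ℕ.* ∣ b ∣) ∣ ≡⟨ cong ∣_∣ (sym (cong₂ _+_ (square≡ a) (square≡ b))) ⟩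
  ∣ a * a + b * b ∣               ∎
  where
  open ℕ.≤-Reasoning
  n≤n*n : ∀ n → n ℕ.≤ n ℕ.* n
  n≤n*n zero    = ℕ.z≤n
  n≤n*n (suc n) = ℕ.m≤m*n (suc n) (suc n)
  square≡ : ∀ a → a * a ≡ + (∣ a ∣ ℕ.* ∣ a ∣)
  square≡ (+ n)    = sym (pos-* n n)
  square≡ -[1+ n ] = refl

∣s∣≤∣centred∣ : ∀ p .{{_ : NonZero p}} s x → ∣ s ∣ ℕ.≤ ∣ + p * s + + 6 * x ∣ ℕ.+ 6 ℕ.* ∣ x ∣
∣s∣≤∣centred∣ p s x = begin
  ∣ s ∣                                       ≤⟨ ℕ.m≤n*m ∣ s ∣ p ⟩
  p ℕ.* ∣ s ∣                                 ≡⟨ sym (abs-* (+ p) s) ⟩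
  ∣ + p * s ∣                                 ≡⟨ cong ∣_∣ (lemma (+ p * s) (+ 6 * x)) ⟩
  ∣ (+ p * s + + 6 * x) - + 6 * x ∣           ≤⟨ ∣i-j∣≤∣i∣+∣j∣ (+ p * s + + 6 * x) (+ 6 * x) ⟩
  ∣ + p * s + + 6 * x ∣ ℕ.+ ∣ + 6 * x ∣       ≡⟨ cong (∣ + p * s + + 6 * x ∣ ℕ.+_) (abs-* (+ 6) x) ⟩
  ∣ + p * s + + 6 * x ∣ ℕ.+ 6 ℕ.* ∣ x ∣       ∎
  where
  open ℕ.≤-Reasoning
  lemma : ∀ a b → a ≡ a + b - b
  lemma = solve-∀

solutionBound : ℤ → ℤ → ℕ → ℤ → ℕ
solutionBound x y p t = ∣ solutionNorm x y (+ p) t ∣ ℕ.+ 6 ℕ.* (∣ x ∣ ℕ.+ ∣ y ∣)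

solution-bounded : ∀ {x y p t s₁ s₂} .{{_ : NonZero p}} → Solution x y (+ p) t (s₁ , s₂) →
  ∣ s₁ ∣ ℕ.≤ solutionBound x y p t × ∣ s₂ ∣ ℕ.≤ solutionBound x y p t
solution-bounded {x} {y} {p} {t} {s₁} {s₂} solution =
    ℕ.≤-trans (coordinate s₁ x (∣a∣≤‖a,b‖² u v)) (ℕ.+-monoʳ-≤ K (ℕ.*-monoʳ-≤ 6 (ℕ.m≤m+n ∣ x ∣ ∣ y ∣)))
  , ℕ.≤-trans (coordinate s₂ y (subst (λ n → ∣ v ∣ ℕ.≤ ∣ n ∣) (+-comm (v * v) (u * u)) (∣a∣≤‖a,b‖² v u)))
              (ℕ.+-monoʳ-≤ K (ℕ.*-monoʳ-≤ 6 (ℕ.m≤n+m ∣ y ∣ ∣ x ∣)))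
  where
  u = + p * s₁ + + 6 * x
  v = + p * s₂ + + 6 * y
  K = ∣ solutionNorm x y (+ p) t ∣
  ‖u,v‖²≡ : ‖ (u , v) ‖² ≡ solutionNorm x y (+ p) t
  ‖u,v‖²≡ = solution⇒norm {x} {y} {+ p} {t} (s₁ , s₂) solution
  coordinate : ∀ s c → ∣ + p * s + + 6 * c ∣ ℕ.≤ ∣ ‖ (u , v) ‖² ∣ → ∣ s ∣ ℕ.≤ K ℕ.+ 6 ℕ.* ∣ c ∣
  coordinate s c le = ℕ.≤-trans (∣s∣≤∣centred∣ p s c)
    (ℕ.+-monoˡ-≤ (6 ℕ.* ∣ c ∣) (subst (λ n → ∣ + p * s + + 6 * c ∣ ℕ.≤ ∣ n ∣) ‖u,v‖²≡ le))

∈-range : ∀ {N k} → ∣ k ∣ ℕ.≤ N → k ∈ range N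
∈-range {N} {+ a} a≤N = subst (_∈ range N) (trans (cong (_- + N) (pos-+ a N)) (lemma (+ a) (+ N)))
  (∈-map⁺ (λ i → + i - + N) (∈-upTo⁺ (ℕ.s≤s (ℕ.+-monoˡ-≤ N a≤N))))
  where lemma : ∀ a n → a + n - n ≡ a
        lemma = solve-∀
∈-range {N} { -[1+ a ]} a<N with ℕ.m≤n⇒∃[o]m+o≡n a<N
... | r , refl = subst (_∈ range N) (trans (cong (_-_ (+ r)) (pos-+ (suc a) r)) (lemma (+ suc a) (+ r)))
  (∈-map⁺ (λ i → + i - + N) (∈-upTo⁺ (ℕ.s≤s (ℕ.≤-trans (ℕ.m≤n+m r (suc a)) (ℕ.m≤m+n _ _)))))
  where lemma : ∀ a r → r - (a + r) ≡ - a
        lemma = solve-∀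

coprimeTo6⇒encoded : ∀ s → CoprimeTo6 s → ∃[ k ] ∃[ i ] s ≡ encode (k , i)
coprimeTo6⇒encoded s (2∤s , 3∤s) = go (s /ℕ 6) (s %ℕ 6) (n%ℕd<d s 6) (a≡a%ℕn+[a/ℕn]*n s 6)
  where
  go : ∀ q r → r ℕ.< 6 → s ≡ + r + q * + 6 → ∃[ k ] ∃[ i ] s ≡ encode (k , i)
  go q 0 _ refl = contradiction (divides (q * + 3) (lemma q)) 2∤s
    where lemma : ∀ q → + 0 + q * + 6 ≡ q * + 3 * + 2
          lemma = solve-∀
  go q 1 _ refl = q , false , lemma q
    where lemma : ∀ q → + 1 + q * + 6 ≡ + 6 * q + 1ℤ
          lemma = solve-∀
  go q 2 _ refl = contradiction (divides (q * + 3 + 1ℤ) (lemma q)) 2∤s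
    where lemma : ∀ q → + 2 + q * + 6 ≡ (q * + 3 + 1ℤ) * + 2
          lemma = solve-∀
  go q 3 _ refl = contradiction (divides (q * + 2 + 1ℤ) (lemma q)) 3∤s
    where lemma : ∀ q → + 3 + q * + 6 ≡ (q * + 2 + 1ℤ) * + 3
          lemma = solve-∀
  go q 4 _ refl = contradiction (divides (q * + 3 + + 2) (lemma q)) 2∤s
    where lemma : ∀ q → + 4 + q * + 6 ≡ (q * + 3 + + 2) * + 2
          lemma = solve-∀
  go q 5 _ refl = q + 1ℤ , true , lemma q
    where lemma : ∀ q → + 5 + q * + 6 ≡ + 6 * (q + 1ℤ) + -1ℤ
          lemma = solve-∀
  go q (suc (suc (suc (suc (suc (suc _)))))) (ℕ.s≤s (ℕ.s≤s (ℕ.s≤s (ℕ.s≤s (ℕ.s≤s (ℕ.s≤s ())))))) _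

∣k∣≤∣encode∣+1 : ∀ k i → ∣ k ∣ ℕ.≤ suc ∣ encode (k , i) ∣
∣k∣≤∣encode∣+1 k i = begin
  ∣ k ∣                               ≤⟨ ℕ.m≤n*m ∣ k ∣ 6 ⟩
  6 ℕ.* ∣ k ∣                         ≡⟨ sym (abs-* (+ 6) k) ⟩
  ∣ + 6 * k ∣                         ≡⟨ cong ∣_∣ (lemma (+ 6 * k) (ε i)) ⟩
  ∣ encode (k , i) - ε i ∣            ≤⟨ ∣i-j∣≤∣i∣+∣j∣ (encode (k , i)) (ε i) ⟩
  ∣ encode (k , i) ∣ ℕ.+ ∣ ε i ∣      ≡⟨ cong (∣ encode (k , i) ∣ ℕ.+_) (∣ε∣≡1 i) ⟩
  ∣ encode (k , i) ∣ ℕ.+ 1            ≡⟨ ℕ.+-comm _ 1 ⟩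
  suc ∣ encode (k , i) ∣              ∎
  where
  open ℕ.≤-Reasoning
  lemma : ∀ a e → a ≡ a + e - e
  lemma = solve-∀
  ∣ε∣≡1 : ∀ i → ∣ ε i ∣ ≡ 1
  ∣ε∣≡1 true  = refl
  ∣ε∣≡1 false = refl

indices-∋ : ∀ {N s} → CoprimeTo6 s → ∣ s ∣ ℕ.< N → s ∈ indices N
indices-∋ {N} {s} coprime ∣s∣<N with coprimeTo6⇒encoded s coprime
... | k , i , refl =
  ∈-map⁺ encode {x = k , i} (∈-cartesianProduct⁺ (∈-range (ℕ.≤-trans (∣k∣≤∣encode∣+1 k i) ∣s∣<N)) (signs-∋ i))
  where
  signs-∋ : ∀ i → i ∈ signs
  signs-∋ true  = here refl
  signs-∋ false = there (here refl)

3∣ε-ε : ∀ k l i j → encode (k , i) ≡ encode (l , j) → + 3 ∣′ ε i - ε j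
3∣ε-ε k l i j e = divides (+ 2 * (l - k)) (begin
  ε i - ε j                          ≡⟨ lemma (+ 6 * k) (ε i) (ε j) ⟩
  (+ 6 * k + ε i) - + 6 * k - ε j     ≡⟨ cong (λ z → z - + 6 * k - ε j) e ⟩
  (+ 6 * l + ε j) - + 6 * k - ε j     ≡⟨ lemma′ k l (ε j) ⟩
  + 2 * (l - k) * + 3                 ∎)
  where
  open ≡-Reasoning
  lemma : ∀ u a c → a - c ≡ u + a - u - c
  lemma = solve-∀
  lemma′ : ∀ k l c → + 6 * l + c - + 6 * k - c ≡ + 2 * (l - k) * + 3
  lemma′ = solve-∀

encode-injective : ∀ {a b} → encode a ≡ encode b → a ≡ b
encode-injective {k , true}  {l , true}  e = cong (_, true)  (*-cancelˡ-≡ (+ 6) k l (+-cancelʳ -1ℤ _ _ e))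
encode-injective {k , false} {l , false} e = cong (_, false) (*-cancelˡ-≡ (+ 6) k l (+-cancelʳ 1ℤ _ _ e))
encode-injective {k , true}  {l , false} e = contradiction (3∣ε-ε k l true false e) (from-no (+ 3 ∣′? - + 2))
encode-injective {k , false} {l , true}  e = contradiction (3∣ε-ε k l false true e) ¬3∣2

indices-unique : ∀ N → Unique (indices N)
indices-unique N = map⁺ encode-injective (cartesianProduct⁺ range-unique signs-unique)
  where
  signs-unique : Unique signs
  signs-unique = ((λ ()) ∷ []) ∷ [] ∷ []
  range-unique : Unique (range N)
  range-unique = map⁺ (λ {i} {j} e → +-injective (+-cancelʳ (- + N) _ _ e)) (upTo⁺ _)

sign-reverse : ∀ {s₁ s₂ s₁′ s₂′} → ¬ + 3 ∣′ s₁ → ¬ + 3 ∣′ s₂ →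
  + 3 ∣′ s₁′ * s₂′ + s₁ * s₂ → sign (s₁′ , s₂′) ≡ - sign (s₁ , s₂)
sign-reverse {s₁} {s₂} {s₁′} {s₂′} 3∤s₁ 3∤s₂ 3∣z′+z with residue3 (s₁ * s₂)
... | inj₁ 3∣z          = contradiction (euclidsLemmaℤ s₁ s₂ prime[3] 3∣z) [ 3∤s₁ , 3∤s₂ ]′
... | inj₂ (inj₁ 3∣z-1) =
  trans (sign≡-1 {s₁′} {s₂′} (subst (_ ∣′_) (lemma (s₁′ * s₂′) (s₁ * s₂)) (∣m∣n⇒∣m-n 3∣z′+z 3∣z-1)))
        (cong -_ (sym (sign≡1 {s₁} {s₂} 3∣z-1)))
  where lemma : ∀ z′ z → z′ + z - (z - 1ℤ) ≡ z′ + 1ℤ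
        lemma = solve-∀
... | inj₂ (inj₂ 3∣z+1) =
  trans (sign≡1 {s₁′} {s₂′} (subst (_ ∣′_) (lemma (s₁′ * s₂′) (s₁ * s₂)) (∣m∣n⇒∣m-n 3∣z′+z 3∣z+1)))
        (cong -_ (sym (sign≡-1 {s₁} {s₂} 3∣z+1)))
  where lemma : ∀ z′ z → z′ + z - (z + 1ℤ) ≡ z′ - 1ℤ
        lemma = solve-∀

record SignReversingInvolution (x y P t : ℤ) : Set where
  field
    σ            : ℤ × ℤ → ℤ × ℤ
    σ-solution   : ∀ {s} → Solution x y P t s → Solution x y P t (σ s)
    σ-involutive : ∀ {s} → Solution x y P t s → σ (σ s) ≡ s
    σ-sign       : ∀ {s} → Solution x y P t s → sign (σ s) ≡ - sign s

signReversingInvolution⇒coeffZero : ∀ {x y p t} .{{_ : NonZero p}} → + 4 ∣′ + p - 1ℤ → ¬ + 3 ∣′ + p →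
  SignReversingInvolution x y (+ p) t → CoeffZero x y (+ p) t
signReversingInvolution⇒coeffZero {x} {y} {p} {t} 4∣p-1 3∤p inv = suc (solutionBound x y p t) , vanishes
  where
  open SignReversingInvolution inv
  h = contribution x y (+ p) t
  h≢0⇒solution : ∀ {s} → h s ≢ 0ℤ → Solution x y (+ p) t s
  h≢0⇒solution {s} hs≢0 with pairExponent x y (+ p) s ≟ + 24 * t
  ... | yes solution = solution
  ... | no  _        = contradiction refl hs≢0
  h≡sign : ∀ {s} → Solution x y (+ p) t s → h s ≡ sign s
  h≡sign {s} solution =
    cong (λ b → if b then sign s else 0ℤ) (dec-true (pairExponent x y (+ p) s ≟ + 24 * t) solution)
  vanishes : ∀ N → suc (solutionBound x y p t) ℕ.≤ N → truncCoeff x y (+ p) N t ≡ 0ℤ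
  vanishes N bound<N = trans (truncCoeff-as-sum x y (+ p) N t)
    (sumℤ-involution≡0 h σ (λ {s} hs≢0 → σ-involutive (h≢0⇒solution {s} hs≢0)) σ-reverses L
                       (cartesianProduct⁺ (indices-unique N) (indices-unique N)) closed)
    where
    L = cartesianProduct (indices N) (indices N)
    σ-reverses : ∀ {s} → h s ≢ 0ℤ → h (σ s) ≡ - h s
    σ-reverses {s} hs≢0 = let solution = h≢0⇒solution {s} hs≢0 in
      trans (h≡sign {σ s} (σ-solution solution))
            (trans (σ-sign solution) (cong -_ (sym (h≡sign {s} solution))))
    closed : ∀ {s} → s ∈ L → h s ≢ 0ℤ → σ s ∈ L
    closed {s} _ hs≢0 =
      ∈-cartesianProduct⁺ (indices-∋ coprime₁ (within bounded₁)) (indices-∋ coprime₂ (within bounded₂))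
      where
      s₁ = proj₁ (σ s)
      s₂ = proj₂ (σ s)
      solution : Solution x y (+ p) t (s₁ , s₂)
      solution = σ-solution (h≢0⇒solution {s} hs≢0)
      coprime₁ = proj₁ (solution⇒coprimeTo6 {x} {y} {+ p} {t} {s₁} {s₂} 4∣p-1 3∤p solution)
      coprime₂ = proj₂ (solution⇒coprimeTo6 {x} {y} {+ p} {t} {s₁} {s₂} 4∣p-1 3∤p solution)
      bounded₁ = proj₁ (solution-bounded {x} {y} {p} {t} {s₁} {s₂} solution)
      bounded₂ = proj₂ (solution-bounded {x} {y} {p} {t} {s₁} {s₂} solution)
      within : ∀ {n} → n ℕ.≤ solutionBound x y p t → n ℕ.< N
      within n≤bound = ℕ.≤-trans (ℕ.s≤s n≤bound) bound<N

-- Reflections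

-- (μ, ν) are the coordinates of a Gaussian integer ρ of norm p, and π = m + ni.  The map
-- mirror is z ↦ ρπz̄, and σ is w ↦ ρπw̄/p read in the coordinates w = P s + 6bπ (centred).
module Reflection (p : ℕ) .{{_ : NonZero p}} (m n : ℤ) (p≡m²+n² : + p ≡ m * m + n * n)
                  (μ ν : ℤ) (p≡μ²+ν² : + p ≡ μ * μ + ν * ν) (b : ℤ) where

  P = + p
  x = b * m
  y = b * n
  α = μ * m - ν * n
  β = μ * n + ν * m
  c₁ = + 6 * b * (μ - m)
  c₂ = + 6 * b * (ν - n)

  mirror : ℤ × ℤ → ℤ × ℤ
  mirror (a , c) = (α * a + β * c , β * a - α * c)

  reflect₁ reflect₂ : ℤ × ℤ → ℤ
  reflect₁ (s₁ , s₂) = α * s₁ + β * s₂ + c₁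
  reflect₂ (s₁ , s₂) = β * s₁ - α * s₂ + c₂

  σ : ℤ × ℤ → ℤ × ℤ
  σ s = (reflect₁ s /ℕ p , reflect₂ s /ℕ p)

  Reflects : ℤ → Set
  Reflects t = ∀ {s} → Solution x y P t s → P ∣′ reflect₁ s × P ∣′ reflect₂ s

  α²+β²≡P*P : α * α + β * β ≡ P * P
  α²+β²≡P*P = trans (lemma μ ν m n) (sym (cong₂ _*_ p≡μ²+ν² p≡m²+n²))
    where lemma : ∀ μ ν m n → (μ * m - ν * n) * (μ * m - ν * n) + (μ * n + ν * m) * (μ * n + ν * m)
                            ≡ (μ * μ + ν * ν) * (m * m + n * n)
          lemma = solve-∀

  ‖mirror‖² : ∀ v → ‖ mirror v ‖² ≡ P * P * ‖ v ‖²
  ‖mirror‖² (a , c) = trans (lemma α β a c) (cong (_* (a * a + c * c)) α²+β²≡P*P)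
    where lemma : ∀ α β a c → (α * a + β * c) * (α * a + β * c) + (β * a - α * c) * (β * a - α * c)
                            ≡ (α * α + β * β) * (a * a + c * c)
          lemma = solve-∀

  P*P-cancel : ∀ {a c} → P * P * a ≡ P * P * c → a ≡ c
  P*P-cancel {a} {c} e =
    *-cancelˡ-≡ P a c (*-cancelˡ-≡ P _ _ (trans (sym (*-assoc P P a)) (trans e (*-assoc P P c))))

  module _ {s : ℤ × ℤ} (P∣₁ : P ∣′ reflect₁ s) (P∣₂ : P ∣′ reflect₂ s) where

    private
      s₁ = proj₁ s
      s₂ = proj₂ s
      σ₁ = proj₁ (σ s)
      σ₂ = proj₂ (σ s)

    P*σ₁ : P * σ₁ ≡ reflect₁ s
    P*σ₁ = trans (*-comm P _) (/ℕ-exact (reflect₁ s) p P∣₁)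

    P*σ₂ : P * σ₂ ≡ reflect₂ s
    P*σ₂ = trans (*-comm P _) (/ℕ-exact (reflect₂ s) p P∣₂)

    mirror-centred : (P * (P * σ₁ + + 6 * x) , P * (P * σ₂ + + 6 * y)) ≡ mirror (centred x y P s)
    mirror-centred = cong₂ _,_
      (trans (cong (λ z → P * (z + + 6 * x)) P*σ₁) (first P p≡m²+n²))
      (trans (cong (λ z → P * (z + + 6 * y)) P*σ₂) (second P p≡m²+n²))
      where
      -- Abstracting P as Q lets refl replace it by m² + n², so that the ring solver applies.
      first : ∀ Q → Q ≡ m * m + n * n →
        Q * (reflect₁ s + + 6 * x) ≡ α * (Q * s₁ + + 6 * x) + β * (Q * s₂ + + 6 * y)
      first _ refl = lemma μ ν m n b s₁ s₂
        where lemma : ∀ μ ν m n b s₁ s₂ →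
                (m * m + n * n) * ((μ * m - ν * n) * s₁ + (μ * n + ν * m) * s₂ + + 6 * b * (μ - m) + + 6 * (b * m))
                ≡ (μ * m - ν * n) * ((m * m + n * n) * s₁ + + 6 * (b * m))
                  + (μ * n + ν * m) * ((m * m + n * n) * s₂ + + 6 * (b * n))
              lemma = solve-∀
      second : ∀ Q → Q ≡ m * m + n * n →
        Q * (reflect₂ s + + 6 * y) ≡ β * (Q * s₁ + + 6 * x) - α * (Q * s₂ + + 6 * y)
      second _ refl = lemma μ ν m n b s₁ s₂
        where lemma : ∀ μ ν m n b s₁ s₂ →
                (m * m + n * n) * ((μ * n + ν * m) * s₁ - (μ * m - ν * n) * s₂ + + 6 * b * (ν - n) + + 6 * (b * n))
                ≡ (μ * n + ν * m) * ((m * m + n * n) * s₁ + + 6 * (b * m))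
                  - (μ * m - ν * n) * ((m * m + n * n) * s₂ + + 6 * (b * n))
              lemma = solve-∀

    ‖centred-σ‖² : ‖ centred x y P (σ s) ‖² ≡ ‖ centred x y P s ‖²
    ‖centred-σ‖² = P*P-cancel (begin
      P * P * ‖ centred x y P (σ s) ‖²                         ≡⟨ scale P _ _ ⟩
      ‖ (P * (P * σ₁ + + 6 * x) , P * (P * σ₂ + + 6 * y)) ‖²   ≡⟨ cong ‖_‖² mirror-centred ⟩
      ‖ mirror (centred x y P s) ‖²                            ≡⟨ ‖mirror‖² (centred x y P s) ⟩
      P * P * ‖ centred x y P s ‖²                             ∎)
      where
      open ≡-Reasoning
      scale : ∀ P a c → P * P * (a * a + c * c) ≡ (P * a) * (P * a) + (P * c) * (P * c)
      scale = solve-∀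

    σ-preserves : pairExponent x y P (σ s) ≡ pairExponent x y P s
    σ-preserves = *-cancelˡ-≡ P _ _ (+-cancelʳ c₀ _ _ (begin
      P * pairExponent x y P (σ s) + c₀ ≡⟨ pairExponent-centred x y P (σ s) ⟩
      ‖ centred x y P (σ s) ‖²          ≡⟨ ‖centred-σ‖² ⟩
      ‖ centred x y P s ‖²              ≡⟨ sym (pairExponent-centred x y P s) ⟩
      P * pairExponent x y P s + c₀     ∎))
      where
      open ≡-Reasoning
      c₀ = ‖ (P - + 6 * x , P - + 6 * y) ‖²

    reflect-σ₁ : reflect₁ (σ s) ≡ P * s₁
    reflect-σ₁ = *-cancelˡ-≡ P _ _ (begin
      P * reflect₁ (σ s)
        ≡⟨ distribute P α β c₁ σ₁ σ₂ ⟩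
      α * (P * σ₁) + β * (P * σ₂) + P * c₁
        ≡⟨ cong₂ (λ u v → α * u + β * v + P * c₁) P*σ₁ P*σ₂ ⟩
      α * reflect₁ s + β * reflect₂ s + P * c₁
        ≡⟨ mirror² P p≡m²+n² ⟩
      (μ * μ + ν * ν) * P * s₁ + + 6 * x * ((μ * μ + ν * ν) - P)
        ≡⟨ cong (λ R → R * P * s₁ + + 6 * x * (R - P)) (sym p≡μ²+ν²) ⟩
      P * P * s₁ + + 6 * x * (P - P)
        ≡⟨ cancel P s₁ x ⟩
      P * (P * s₁) ∎)
      where
      open ≡-Reasoning
      distribute : ∀ P α β c u v → P * (α * u + β * v + c) ≡ α * (P * u) + β * (P * v) + P * c
      distribute = solve-∀
      cancel : ∀ P s x → P * P * s + + 6 * x * (P - P) ≡ P * (P * s)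
      cancel = solve-∀
      mirror² : ∀ Q → Q ≡ m * m + n * n →
        α * reflect₁ s + β * reflect₂ s + Q * c₁ ≡ (μ * μ + ν * ν) * Q * s₁ + + 6 * x * ((μ * μ + ν * ν) - Q)
      mirror² _ refl = lemma μ ν m n b s₁ s₂
        where lemma : ∀ μ ν m n b s₁ s₂ →
                (μ * m - ν * n) * ((μ * m - ν * n) * s₁ + (μ * n + ν * m) * s₂ + + 6 * b * (μ - m))
                + (μ * n + ν * m) * ((μ * n + ν * m) * s₁ - (μ * m - ν * n) * s₂ + + 6 * b * (ν - n))
                + (m * m + n * n) * (+ 6 * b * (μ - m))
                ≡ (μ * μ + ν * ν) * (m * m + n * n) * s₁ + + 6 * (b * m) * ((μ * μ + ν * ν) - (m * m + n * n))
              lemma = solve-∀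

    reflect-σ₂ : reflect₂ (σ s) ≡ P * s₂
    reflect-σ₂ = *-cancelˡ-≡ P _ _ (begin
      P * reflect₂ (σ s)
        ≡⟨ distribute P α β c₂ σ₁ σ₂ ⟩
      β * (P * σ₁) - α * (P * σ₂) + P * c₂
        ≡⟨ cong₂ (λ u v → β * u - α * v + P * c₂) P*σ₁ P*σ₂ ⟩
      β * reflect₁ s - α * reflect₂ s + P * c₂
        ≡⟨ mirror² P p≡m²+n² ⟩
      (μ * μ + ν * ν) * P * s₂ + + 6 * y * ((μ * μ + ν * ν) - P)
        ≡⟨ cong (λ R → R * P * s₂ + + 6 * y * (R - P)) (sym p≡μ²+ν²) ⟩
      P * P * s₂ + + 6 * y * (P - P)
        ≡⟨ cancel P s₂ y ⟩
      P * (P * s₂) ∎)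
      where
      open ≡-Reasoning
      distribute : ∀ P α β c u v → P * (β * u - α * v + c) ≡ β * (P * u) - α * (P * v) + P * c
      distribute = solve-∀
      cancel : ∀ P s y → P * P * s + + 6 * y * (P - P) ≡ P * (P * s)
      cancel = solve-∀
      mirror² : ∀ Q → Q ≡ m * m + n * n →
        β * reflect₁ s - α * reflect₂ s + Q * c₂ ≡ (μ * μ + ν * ν) * Q * s₂ + + 6 * y * ((μ * μ + ν * ν) - Q)
      mirror² _ refl = lemma μ ν m n b s₁ s₂
        where lemma : ∀ μ ν m n b s₁ s₂ →
                (μ * n + ν * m) * ((μ * m - ν * n) * s₁ + (μ * n + ν * m) * s₂ + + 6 * b * (μ - m))
                - (μ * m - ν * n) * ((μ * n + ν * m) * s₁ - (μ * m - ν * n) * s₂ + + 6 * b * (ν - n))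
                + (m * m + n * n) * (+ 6 * b * (ν - n))
                ≡ (μ * μ + ν * ν) * (m * m + n * n) * s₂ + + 6 * (b * n) * ((μ * μ + ν * ν) - (m * m + n * n))
              lemma = solve-∀

    σ-involutive : σ (σ s) ≡ s
    σ-involutive = cong₂ _,_ (trans (cong (_/ℕ p) reflect-σ₁) ([p*z]/ℕp≡z p s₁))
                             (trans (cong (_/ℕ p) reflect-σ₂) ([p*z]/ℕp≡z p s₂))

    -- Modulo 3 the mirror is diagonal, diag(α, −α), because 3 ∣ β; hence σ₁σ₂ ≡ −s₁s₂.
    3∣σ₁σ₂+s₁s₂ : + 3 ∣′ β → ¬ + 3 ∣′ P → + 3 ∣′ σ₁ * σ₂ + s₁ * s₂
    3∣σ₁σ₂+s₁s₂ 3∣β 3∤P = prime∣*-cancelˡ prime[3] 3∤P*P (subst (_ ∣′_) (sym (begin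
      P * P * (σ₁ * σ₂ + s₁ * s₂)
        ≡⟨ expand P σ₁ σ₂ (s₁ * s₂) ⟩
      (P * σ₁) * (P * σ₂) + P * P * (s₁ * s₂)
        ≡⟨ cong₂ (λ u v → u * v + P * P * (s₁ * s₂)) P*σ₁ P*σ₂ ⟩
      reflect₁ s * reflect₂ s + P * P * (s₁ * s₂)
        ≡⟨ cong (λ c → reflect₁ s * reflect₂ s + c * (s₁ * s₂)) (sym α²+β²≡P*P) ⟩
      reflect₁ s * reflect₂ s + (α * α + β * β) * (s₁ * s₂)
        ≡⟨ lemma μ ν m n b s₁ s₂ ⟩
      β * (α * (s₁ * s₁ - s₂ * s₂) + + 2 * β * (s₁ * s₂)) + F * + 3 ∎))
      (∣m∣n⇒∣m+n (∣m⇒∣m*n _ 3∣β) (divides F refl)))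
      where
      open ≡-Reasoning
      F = + 2 * b * (μ - m) * (β * s₁ - α * s₂) + + 2 * b * (ν - n) * (α * s₁ + β * s₂)
          + + 12 * b * b * (μ - m) * (ν - n)
      3∤P*P : ¬ + 3 ∣′ P * P
      3∤P*P 3∣PP = [ 3∤P , 3∤P ]′ (euclidsLemmaℤ P P prime[3] 3∣PP)
      expand : ∀ P a c d → P * P * (a * c + d) ≡ (P * a) * (P * c) + P * P * d
      expand = solve-∀
      lemma : ∀ μ ν m n b s₁ s₂ →
        ((μ * m - ν * n) * s₁ + (μ * n + ν * m) * s₂ + + 6 * b * (μ - m))
          * ((μ * n + ν * m) * s₁ - (μ * m - ν * n) * s₂ + + 6 * b * (ν - n))
        + ((μ * m - ν * n) * (μ * m - ν * n) + (μ * n + ν * m) * (μ * n + ν * m)) * (s₁ * s₂)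
        ≡ (μ * n + ν * m) * ((μ * m - ν * n) * (s₁ * s₁ - s₂ * s₂) + + 2 * (μ * n + ν * m) * (s₁ * s₂))
          + (+ 2 * b * (μ - m) * ((μ * n + ν * m) * s₁ - (μ * m - ν * n) * s₂)
             + + 2 * b * (ν - n) * ((μ * m - ν * n) * s₁ + (μ * n + ν * m) * s₂)
             + + 12 * b * b * (μ - m) * (ν - n)) * + 3
      lemma = solve-∀

  involution : ∀ {t} → + 4 ∣′ P - 1ℤ → ¬ + 3 ∣′ P → + 3 ∣′ β → Reflects t → SignReversingInvolution x y P t
  involution {t} 4∣P-1 3∤P 3∣β reflects = record
    { σ            = σ
    ; σ-solution   = λ {s} solution → trans (σ-preserves (∣₁ {s} solution) (∣₂ {s} solution)) solution
    ; σ-involutive = λ {s} solution → σ-involutive (∣₁ {s} solution) (∣₂ {s} solution)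
    ; σ-sign       = λ {s} solution →
        let (3∤s₁ , 3∤s₂) = 3∤solution {proj₁ s} {proj₂ s} solution
        in sign-reverse {proj₁ s} {proj₂ s} {proj₁ (σ s)} {proj₂ (σ s)} 3∤s₁ 3∤s₂
                        (3∣σ₁σ₂+s₁s₂ (∣₁ {s} solution) (∣₂ {s} solution) 3∣β 3∤P)
    }
    where
    ∣₁ : ∀ {s} → Solution x y P t s → P ∣′ reflect₁ s
    ∣₁ solution = proj₁ (reflects solution)
    ∣₂ : ∀ {s} → Solution x y P t s → P ∣′ reflect₂ s
    ∣₂ solution = proj₂ (reflects solution)
    3∤solution : ∀ {s₁ s₂} → Solution x y P t (s₁ , s₂) → ¬ + 3 ∣′ s₁ × ¬ + 3 ∣′ s₂
    3∤solution {s₁} {s₂} solution =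
      let (coprime₁ , coprime₂) = solution⇒coprimeTo6 {x} {y} {P} {t} {s₁} {s₂} 4∣P-1 3∤P solution
      in proj₂ coprime₁ , proj₂ coprime₂

module Vanishing {p : ℕ} (p-prime : Prime p) (p≡1[4] : p % 4 ≡ 1)
                 (m n : ℤ) (p≡m²+n² : + p ≡ m * m + n * n)
                 (b w : ℤ) (P∣2w-m-n : + p ∣′ + 2 * w - (m + n)) where

  private
    instance
      p≢0 : NonZero p
      p≢0 = prime⇒nonZero p-prime

  P = + p
  module R = Reflection p m n p≡m²+n²

  4∣P-1 : + 4 ∣′ P - 1ℤ
  4∣P-1 = %⇒∣ p 4 1 p≡1[4]

  3∤P : ¬ + 3 ∣′ P
  3∤P = 3∤p p-prime p≡1[4]

  P∣Π* : ∀ z → P ∣′ (m * m + n * n) * z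
  P∣Π* z = subst (λ q → P ∣′ q * z) p≡m²+n² (∣m⇒∣m*n z ∣-refl)

  residual : ℤ → ℤ × ℤ → ℤ
  residual t (s₁ , s₂) = + 12 * b * (m * s₁ + n * s₂ + (m + n)) - + 24 * t

  P∣residual : ∀ {t s} → Solution (b * m) (b * n) P t s → P ∣′ residual t s
  P∣residual {t} {s₁ , s₂} solution = divides (+ 2 - s₁ * s₁ - s₂ * s₂) (begin
    + 12 * b * (m * s₁ + n * s₂ + (m + n)) - + 24 * t
      ≡⟨ cong (_-_ (+ 12 * b * (m * s₁ + n * s₂ + (m + n)))) (sym solution) ⟩
    + 12 * b * (m * s₁ + n * s₂ + (m + n)) - pairExponent (b * m) (b * n) P (s₁ , s₂)
      ≡⟨ lemma b m n P s₁ s₂ ⟩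
    (+ 2 - s₁ * s₁ - s₂ * s₂) * P ∎)
    where
    open ≡-Reasoning
    lemma : ∀ b m n P s₁ s₂ →
      + 12 * b * (m * s₁ + n * s₂ + (m + n))
        - ((P * (s₁ * s₁ - 1ℤ) + + 12 * (b * m) * (s₁ + 1ℤ)) + (P * (s₂ * s₂ - 1ℤ) + + 12 * (b * n) * (s₂ + 1ℤ)))
      ≡ (+ 2 - s₁ * s₁ - s₂ * s₂) * P
    lemma = solve-∀

  p≡[-m]²+n² : + p ≡ - m * - m + n * n
  p≡[-m]²+n² = trans p≡m²+n² (lemma m n)
    where lemma : ∀ m n → m * m + n * n ≡ - m * - m + n * n
          lemma = solve-∀

  p≡[-m]²+[-n]² : + p ≡ - m * - m + - n * - n
  p≡[-m]²+[-n]² = trans p≡m²+n² (lemma m n)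
    where lemma : ∀ m n → m * m + n * n ≡ - m * - m + - n * - n
          lemma = solve-∀

  p≡n²+[-m]² : + p ≡ n * n + - m * - m
  p≡n²+[-m]² = trans p≡m²+n² (lemma m n)
    where lemma : ∀ m n → m * m + n * n ≡ n * n + - m * - m
          lemma = solve-∀

  p≡[-n]²+m² : + p ≡ - n * - n + m * m
  p≡[-n]²+m² = trans p≡m²+n² (lemma m n)
    where lemma : ∀ m n → m * m + n * n ≡ - n * - n + m * m
          lemma = solve-∀

  reflects[-π̄] : P ∣′ b → ∀ {t} → R.Reflects (- m) n p≡[-m]²+n² b t
  reflects[-π̄] P∣b {t} {s₁ , s₂} _ =
      subst (P ∣′_) (sym (first m n b s₁ s₂)) (∣m∣n⇒∣m+n (P∣Π* (- s₁)) (∣n⇒∣m*n (- (+ 12 * m)) P∣b))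
    , subst (P ∣′_) (sym (second m n b s₁ s₂)) (P∣Π* s₂)
    where
    first : ∀ m n b s₁ s₂ → (- m * m - n * n) * s₁ + (- m * n + n * m) * s₂ + + 6 * b * (- m - m)
                          ≡ (m * m + n * n) * (- s₁) + - (+ 12 * m) * b
    first = solve-∀
    second : ∀ m n b s₁ s₂ → (- m * n + n * m) * s₁ - (- m * m - n * n) * s₂ + + 6 * b * (n - n)
                           ≡ (m * m + n * n) * s₂
    second = solve-∀

  vanishes : ∀ μ ν (p≡μ²+ν² : + p ≡ μ * μ + ν * ν) {t} → + 3 ∣′ μ * n + ν * m →
    (¬ P ∣′ b → R.Reflects μ ν p≡μ²+ν² b t) → CoeffZero (b * m) (b * n) P t
  vanishes μ ν p≡μ²+ν² 3∣β reflects with P ∣′? b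
  ... | yes P∣b = signReversingInvolution⇒coeffZero 4∣P-1 3∤P
    (R.involution (- m) n p≡[-m]²+n² b 4∣P-1 3∤P (divides 0ℤ (lemma m n)) (reflects[-π̄] P∣b))
    where lemma : ∀ m n → - m * n + n * m ≡ 0ℤ * + 3
          lemma = solve-∀
  ... | no  P∤b = signReversingInvolution⇒coeffZero 4∣P-1 3∤P
    (R.involution μ ν p≡μ²+ν² b 4∣P-1 3∤P 3∣β (reflects P∤b))

  private
    P∣-via-residual : ∀ {t s} → ¬ P ∣′ b → Solution (b * m) (b * n) P t s → ∀ c d {e z} → P ∣′ e →
      + 12 * b * z ≡ c * residual t s + d * (+ 2 * w - (m + n)) + e → P ∣′ z
    P∣-via-residual P∤b solution c d P∣e eq =
      prime∣*-cancelˡ p-prime (p∤12* p-prime p≡1[4] P∤b) (subst (P ∣′_) (sym eq)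
        (∣m∣n⇒∣m+n (∣m∣n⇒∣m+n (∣n⇒∣m*n c (P∣residual solution)) (∣n⇒∣m*n d P∣2w-m-n)) P∣e))

    P∣P* : ∀ z → P ∣′ P * z
    P∣P* z = ∣m⇒∣m*n z ∣-refl

  reflects[π] : ¬ P ∣′ b → ∀ t₀ → R.Reflects m n p≡m²+n² b (P * t₀ + b * w)
  reflects[π] P∤b t₀ {s₁ , s₂} solution =
      subst (P ∣′_) (sym (first m n b s₁ s₂)) (∣m∣n⇒∣m-n (∣n⇒∣m*n (+ 2 * m) P∣Z) (P∣Π* s₁))
    , subst (P ∣′_) (sym (second m n b s₁ s₂)) (∣m∣n⇒∣m-n (∣n⇒∣m*n (+ 2 * n) P∣Z) (P∣Π* s₂))
    where
    P∣Z : P ∣′ m * s₁ + n * s₂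
    P∣Z = P∣-via-residual P∤b solution 1ℤ (+ 12 * b) (P∣P* (+ 24 * t₀)) (lemma P b m n w t₀ s₁ s₂)
      where lemma : ∀ P b m n w t₀ s₁ s₂ →
              + 12 * b * (m * s₁ + n * s₂)
              ≡ 1ℤ * (+ 12 * b * (m * s₁ + n * s₂ + (m + n)) - + 24 * (P * t₀ + b * w))
                + + 12 * b * (+ 2 * w - (m + n)) + P * (+ 24 * t₀)
            lemma = solve-∀
    first : ∀ m n b s₁ s₂ → (m * m - n * n) * s₁ + (m * n + n * m) * s₂ + + 6 * b * (m - m)
                          ≡ + 2 * m * (m * s₁ + n * s₂) - (m * m + n * n) * s₁
    first = solve-∀
    second : ∀ m n b s₁ s₂ → (m * n + n * m) * s₁ - (m * m - n * n) * s₂ + + 6 * b * (n - n)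
                           ≡ + 2 * n * (m * s₁ + n * s₂) - (m * m + n * n) * s₂
    second = solve-∀

  reflects[-π] : ¬ P ∣′ b → ∀ t₀ → R.Reflects (- m) (- n) p≡[-m]²+[-n]² b (P * t₀ + b * (w - + 3 * b))
  reflects[-π] P∤b t₀ {s₁ , s₂} solution =
      subst (P ∣′_) (sym (first m n b s₁ s₂)) (∣m∣n⇒∣m-n (P∣Π* s₁) (∣n⇒∣m*n (+ 2 * m) P∣Z))
    , subst (P ∣′_) (sym (second m n b s₁ s₂)) (∣m∣n⇒∣m-n (P∣Π* s₂) (∣n⇒∣m*n (+ 2 * n) P∣Z))
    where
    P∣Z : P ∣′ m * s₁ + n * s₂ + + 6 * b
    P∣Z = P∣-via-residual P∤b solution 1ℤ (+ 12 * b) (P∣P* (+ 24 * t₀)) (lemma P b m n w t₀ s₁ s₂)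
      where lemma : ∀ P b m n w t₀ s₁ s₂ →
              + 12 * b * (m * s₁ + n * s₂ + + 6 * b)
              ≡ 1ℤ * (+ 12 * b * (m * s₁ + n * s₂ + (m + n)) - + 24 * (P * t₀ + b * (w - + 3 * b)))
                + + 12 * b * (+ 2 * w - (m + n)) + P * (+ 24 * t₀)
            lemma = solve-∀
    first : ∀ m n b s₁ s₂ → (- m * m - - n * n) * s₁ + (- m * n + - n * m) * s₂ + + 6 * b * (- m - m)
                          ≡ (m * m + n * n) * s₁ - + 2 * m * (m * s₁ + n * s₂ + + 6 * b)
    first = solve-∀
    second : ∀ m n b s₁ s₂ → (- m * n + - n * m) * s₁ - (- m * m - - n * n) * s₂ + + 6 * b * (- n - n)
                           ≡ (m * m + n * n) * s₂ - + 2 * n * (m * s₁ + n * s₂ + + 6 * b)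
    second = solve-∀

  reflects[-iπ] : ¬ P ∣′ b → ∀ m̄ → P ∣′ m * m̄ - 1ℤ → ∀ t₀ →
    R.Reflects n (- m) p≡n²+[-m]² b (P * t₀ + b * w * (1ℤ - + 3 * b * m̄))
  reflects[-iπ] P∤b m̄ P∣mm̄-1 t₀ {s₁ , s₂} solution =
      prime∣*-cancelˡ p-prime (p∤summand m n p-prime p≡m²+n²)
        (subst (P ∣′_) (sym (first m n b s₁ s₂)) (∣m∣n⇒∣m-n (∣n⇒∣m*n (+ 2 * n) P∣Z) (P∣Π* (+ 6 * b + m * s₂))))
    , subst (P ∣′_) (sym (second m n b s₁ s₂)) (∣m∣n⇒∣m-n (P∣Π* s₁) (∣n⇒∣m*n (+ 2) P∣Z))
    where
    P∣Z : P ∣′ m * (m * s₁ + n * s₂) + + 3 * b * (m + n)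
    P∣Z = P∣-via-residual P∤b solution m (+ 12 * b * m - + 36 * b * b)
            (∣m∣n⇒∣m-n (P∣P* (+ 24 * m * t₀)) (∣n⇒∣m*n (+ 72 * b * b * w) P∣mm̄-1)) (lemma P b m n w m̄ t₀ s₁ s₂)
      where lemma : ∀ P b m n w m̄ t₀ s₁ s₂ →
              + 12 * b * (m * (m * s₁ + n * s₂) + + 3 * b * (m + n))
              ≡ m * (+ 12 * b * (m * s₁ + n * s₂ + (m + n)) - + 24 * (P * t₀ + b * w * (1ℤ - + 3 * b * m̄)))
                + (+ 12 * b * m - + 36 * b * b) * (+ 2 * w - (m + n))
                + (P * (+ 24 * m * t₀) - + 72 * b * b * w * (m * m̄ - 1ℤ))
            lemma = solve-∀
    first : ∀ m n b s₁ s₂ → m * ((n * m - - m * n) * s₁ + (n * n + - m * m) * s₂ + + 6 * b * (n - m))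
                          ≡ + 2 * n * (m * (m * s₁ + n * s₂) + + 3 * b * (m + n)) - (m * m + n * n) * (+ 6 * b + m * s₂)
    first = solve-∀
    second : ∀ m n b s₁ s₂ → (n * n + - m * m) * s₁ - (n * m - - m * n) * s₂ + + 6 * b * (- m - n)
                           ≡ (m * m + n * n) * s₁ - + 2 * (m * (m * s₁ + n * s₂) + + 3 * b * (m + n))
    second = solve-∀

  reflects[iπ] : ¬ P ∣′ b → ∀ n̄ → P ∣′ n * n̄ - 1ℤ → ∀ t₀ →
    R.Reflects (- n) m p≡[-n]²+m² b (P * t₀ + b * w * (1ℤ - + 3 * b * n̄))
  reflects[iπ] P∤b n̄ P∣nn̄-1 t₀ {s₁ , s₂} solution =
      subst (P ∣′_) (sym (first m n b s₁ s₂)) (∣m∣n⇒∣m-n (P∣Π* s₂) (∣n⇒∣m*n (+ 2) P∣Z))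
    , prime∣*-cancelˡ p-prime (p∤summand n m p-prime (trans p≡m²+n² (+-comm (m * m) (n * n))))
        (subst (P ∣′_) (sym (second m n b s₁ s₂)) (∣m∣n⇒∣m-n (∣n⇒∣m*n (+ 2 * m) P∣Z) (P∣Π* (+ 6 * b + n * s₁))))
    where
    P∣Z : P ∣′ n * (m * s₁ + n * s₂) + + 3 * b * (m + n)
    P∣Z = P∣-via-residual P∤b solution n (+ 12 * b * n - + 36 * b * b)
            (∣m∣n⇒∣m-n (P∣P* (+ 24 * n * t₀)) (∣n⇒∣m*n (+ 72 * b * b * w) P∣nn̄-1)) (lemma P b m n w n̄ t₀ s₁ s₂)
      where lemma : ∀ P b m n w n̄ t₀ s₁ s₂ →
              + 12 * b * (n * (m * s₁ + n * s₂) + + 3 * b * (m + n))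
              ≡ n * (+ 12 * b * (m * s₁ + n * s₂ + (m + n)) - + 24 * (P * t₀ + b * w * (1ℤ - + 3 * b * n̄)))
                + (+ 12 * b * n - + 36 * b * b) * (+ 2 * w - (m + n))
                + (P * (+ 24 * n * t₀) - + 72 * b * b * w * (n * n̄ - 1ℤ))
            lemma = solve-∀
    first : ∀ m n b s₁ s₂ → (- n * m - m * n) * s₁ + (- n * n + m * m) * s₂ + + 6 * b * (- n - m)
                          ≡ (m * m + n * n) * s₂ - + 2 * (n * (m * s₁ + n * s₂) + + 3 * b * (m + n))
    first = solve-∀
    second : ∀ m n b s₁ s₂ → n * ((- n * n + m * m) * s₁ - (- n * m - m * n) * s₂ + + 6 * b * (m - n))
                           ≡ + 2 * m * (n * (m * s₁ + n * s₂) + + 3 * b * (m + n)) - (m * m + n * n) * (+ 6 * b + n * s₁)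
    second = solve-∀

  vanishes-at-bw : p % 12 ≡ 1 → ∀ t → CoeffZero (b * m) (b * n) P (P * t + b * w)
  vanishes-at-bw p≡1[12] t = vanishes m n p≡m²+n² 3∣β (λ P∤b → reflects[π] P∤b t)
    where
    lemma : ∀ m n → + 2 * (m * n) ≡ m * n + n * m
    lemma = solve-∀
    3∣β = subst (_ ∣′_) (lemma m n) (∣n⇒∣m*n (+ 2) (p≡1[12]⇒3∣mn m n p≡m²+n² p≡1[12]))

  vanishes-at-b[w-3b] : p % 12 ≡ 1 → ∀ t → CoeffZero (b * m) (b * n) P (P * t + b * (w - + 3 * b))
  vanishes-at-b[w-3b] p≡1[12] t = vanishes (- m) (- n) p≡[-m]²+[-n]² 3∣β (λ P∤b → reflects[-π] P∤b t)
    where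
    lemma : ∀ m n → - + 2 * (m * n) ≡ - m * n + - n * m
    lemma = solve-∀
    3∣β = subst (_ ∣′_) (lemma m n) (∣n⇒∣m*n (- + 2) (p≡1[12]⇒3∣mn m n p≡m²+n² p≡1[12]))

  vanishes-at-bw[1-3bm̄] : p % 12 ≡ 5 → ∀ m̄ → P ∣′ m * m̄ - 1ℤ → ∀ t →
    CoeffZero (b * m) (b * n) P (P * t + b * w * (1ℤ - + 3 * b * m̄))
  vanishes-at-bw[1-3bm̄] p≡5[12] m̄ P∣mm̄-1 t =
    vanishes n (- m) p≡n²+[-m]² 3∣β (λ P∤b → reflects[-iπ] P∤b m̄ P∣mm̄-1 t)
    where
    lemma : ∀ m n → 1ℤ * (n * n - m * m) ≡ n * n + - m * m
    lemma = solve-∀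
    3∣β = subst (_ ∣′_) (lemma m n) (∣n⇒∣m*n 1ℤ (p≡5[12]⇒3∣n²-m² m n p≡m²+n² p≡5[12]))

  vanishes-at-bw[1-3bn̄] : p % 12 ≡ 5 → ∀ n̄ → P ∣′ n * n̄ - 1ℤ → ∀ t →
    CoeffZero (b * m) (b * n) P (P * t + b * w * (1ℤ - + 3 * b * n̄))
  vanishes-at-bw[1-3bn̄] p≡5[12] n̄ P∣nn̄-1 t =
    vanishes (- n) m p≡[-n]²+m² 3∣β (λ P∤b → reflects[iπ] P∤b n̄ P∣nn̄-1 t)
    where
    lemma : ∀ m n → -1ℤ * (n * n - m * m) ≡ - n * n + m * m
    lemma = solve-∀
    3∣β = subst (_ ∣′_) (lemma m n) (∣n⇒∣m*n -1ℤ (p≡5[12]⇒3∣n²-m² m n p≡m²+n² p≡5[12]))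

theorem1p1 : (p : ℕ) → Prime p → p % 4 ≡ 1 →
  (m n : ℤ) → + p ≡ m * m + n * n →
  (b : ℕ) → 1 Data.Nat.≤ b →
  (w : ℤ) → (+ p) ∣ ((+ 2) * w - (m + n)) →
  (m̄ n̄ : ℤ) → (+ p) ∣ (m * m̄ - 1ℤ) → (+ p) ∣ (n * n̄ - 1ℤ) →
  (p % 12 ≡ 1 → (t : ℤ) →
      CoeffZero (+ b * m) (+ b * n) (+ p) (+ p * t + + b * w)
    × CoeffZero (+ b * m) (+ b * n) (+ p) (+ p * t + + b * (w - (+ 3) * + b)))
  × (p % 12 ≡ 5 → (t : ℤ) →
      CoeffZero (+ b * m) (+ b * n) (+ p) (+ p * t + + b * w * (1ℤ - (+ 3) * + b * m̄))
    × CoeffZero (+ b * m) (+ b * n) (+ p) (+ p * t + + b * w * (1ℤ - (+ 3) * + b * n̄)))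
theorem1p1 p p-prime p≡1[4] m n p≡m²+n² b _ w p∣2w-m-n m̄ n̄ p∣mm̄-1 p∣nn̄-1 =
    (λ p≡1[12] t → vanishes-at-bw p≡1[12] t , vanishes-at-b[w-3b] p≡1[12] t)
  , (λ p≡5[12] t → vanishes-at-bw[1-3bm̄] p≡5[12] m̄ (∣ᵤ⇒∣ p∣mm̄-1) t
                 , vanishes-at-bw[1-3bn̄] p≡5[12] n̄ (∣ᵤ⇒∣ p∣nn̄-1) t)
  where open Vanishing p-prime p≡1[4] m n p≡m²+n² (+ b) w (∣ᵤ⇒∣ p∣2w-m-n)
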